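{- For every positive integer $\Delta$ there is $\mu_0>0$ such that for every $\mu\in(0,\mu_0]$ there is $\rho_0>0$ such that for every $\rho\in(0,\rho_0]$ there is a function $\varepsilon(n)\to 0$ as $n\to\infty$ such that the following holds. Let $G$ be an abelian group of order $n$, let $p\geq n^{ -\rho}$ and let $X\subseteq G$ be a $p$-random subset. Then with probability at least $1-\varepsilon(n)$ the following holds: for every $b\in G$ and all $N,U\subseteq G$ with $|U|\leq n^{1-\mu}$ and $|N|\leq\Delta$, there are elements $x,y,z\in X\setminus U$ with $x+y+z=b$ such that the sets $x+N$, $y+N$, $z+N$ are pairwise disjoint and contained in $X\setminus U$.
   Context: A $p$-random subset of $G$ contains each element of $G$ independently with probability $p$. For $x\in G$ and $N\subseteq G$, $x+N=\{x+a:a\in N\}$.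
   Formalization: The parameters μ and ρ and the probability p range over the rationals, and μ₀, ρ₀ and the values of ε(n) are also taken among the rationals. -}

module Defs where

open import Level using (0ℓ)
open import Data.Nat as ℕ using (ℕ; zero; suc)
open import Data.Integer as ℤ using (ℤ)
open import Data.Rational as ℚ using (ℚ; 0ℚ; 1ℚ)
open import Data.Fin using (Fin)
open import Data.Bool using (Bool; true; false; if_then_else_)
open import Data.Vec using (Vec; []; _∷_)
open import Data.List using (List; []; _∷_; map; _++_; foldr)
open import Data.Product using (Σ; ∃; _×_; _,_)
open import Relation.Binary.PropositionalEquality using (_≡_; _≢_)
open import Algebra.Core using (Op₂; Op₁)
open import Data.Fin.Subset using (Subset; _∈_; _∉_; ∣_∣)
import Algebra.Structures as AS

-- An abelian group of order n, presented (w.l.o.g., up to isomorphism)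
-- with underlying set Fin n and propositional equality.
record FinAbGroup (n : ℕ) : Set where
  field
    _⊕_ : Op₂ (Fin n)
    0g  : Fin n
    ⊖_  : Op₁ (Fin n)
    isAbelianGroup : AS.IsAbelianGroup {A = Fin n} _≡_ _⊕_ 0g ⊖_

_^ℚ_ : ℚ → ℕ → ℚ
x ^ℚ zero  = 1ℚ
x ^ℚ suc k = x ℚ.* (x ^ℚ k)

allSubsets : (n : ℕ) → List (Subset n)
allSubsets zero    = [] ∷ []
allSubsets (suc n) = map (true ∷_) (allSubsets n) ++ map (false ∷_) (allSubsets n)

-- probability that a p-random subset equals X
weight : {n : ℕ} → ℚ → Subset n → ℚ
weight {n} p X = (p ^ℚ ∣ X ∣) ℚ.* ((1ℚ ℚ.- p) ^ℚ (n ℕ.∸ ∣ X ∣))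

-- probability of the (Boolean-indicated) event χ for a p-random subset of Fin n
probOf : (n : ℕ) → ℚ → (Subset n → Bool) → ℚ
probOf n p χ = foldr (λ X acc → (if χ X then weight p X else 0ℚ) ℚ.+ acc) 0ℚ (allSubsets n)

-- "with probability at least t, a p-random subset X of Fin n satisfies E X":
-- some event χ contained in E has probability ≥ t.
ProbAtLeast : (n : ℕ) → ℚ → ℚ → (Subset n → Set) → Set
ProbAtLeast n p t E =
  Σ (Subset n → Bool) λ χ → ((X : Subset n) → χ X ≡ true → E X) × (t ℚ.≤ probOf n p χ)

num : ℚ → ℕ
num q = ℤ.∣ ℚ.↥ q ∣

den : ℚ → ℕ
den q = ℚ.↧ₙ q

-- n ^ (- r) ≤ p, for r = k/d ≥ 0 and p ≥ 0:  equivalent to  p^d · n^k ≥ 1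
NegPowLe : ℕ → ℚ → ℚ → Set
NegPowLe n r p = 1ℚ ℚ.≤ (p ^ℚ den r) ℚ.* ((ℤ.+ (n ℕ.^ num r)) ℚ./ 1)

-- m ≤ n ^ (1 - r), for r = k/d ≥ 0 :  equivalent to  m^d · n^k ≤ n^d
LePow1m : ℕ → ℕ → ℚ → Set
LePow1m m n r = (m ℕ.^ den r) ℕ.* (n ℕ.^ num r) ℕ.≤ n ℕ.^ den r

TendsToZero : (ℕ → ℚ) → Set
TendsToZero ε = (δ : ℚ) → 0ℚ ℚ.< δ → ∃ λ N → (n : ℕ) → N ℕ.≤ n → ℚ.∣ ε n ∣ ℚ.< δ

GoodSet : {n : ℕ} → FinAbGroup n → ℕ → ℚ → Subset n → Set
GoodSet {n} G Δ μ X =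
  (b : Fin n) (N U : Subset n) → LePow1m ∣ U ∣ n μ → ∣ N ∣ ℕ.≤ Δ →
  Σ (Fin n) λ x → Σ (Fin n) λ y → Σ (Fin n) λ z →
    (x ∈ X × x ∉ U) × (y ∈ X × y ∉ U) × (z ∈ X × z ∉ U) ×
    ((x ⊕ y) ⊕ z ≡ b) ×
    ((a a' : Fin n) → a ∈ N → a' ∈ N → x ⊕ a ≢ y ⊕ a') ×
    ((a a' : Fin n) → a ∈ N → a' ∈ N → x ⊕ a ≢ z ⊕ a') ×
    ((a a' : Fin n) → a ∈ N → a' ∈ N → y ⊕ a ≢ z ⊕ a') ×
    ((a : Fin n) → a ∈ N → (x ⊕ a) ∈ X × (x ⊕ a) ∉ U) ×
    ((a : Fin n) → a ∈ N → (y ⊕ a) ∈ X × (y ⊕ a) ∉ U) ×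
    ((a : Fin n) → a ∈ N → (z ⊕ a) ∈ X × (z ⊕ a) ∉ U)
  where open FinAbGroup G

{-# OPTIONS --safe #-}

-- Fix b ∈ G and offsets S = {0} ∪ N (padded to length Δ + 1). A pair (x , y)
-- determines z = b − x − y and the cell (x + S) ∪ (y + S) ∪ (z + S) of at most
-- s = 3(Δ + 1) elements. Greedily choose pairs whose three translates are
-- pairwise disjoint and whose cells are pairwise disjoint: each chosen cell
-- rules out only O(s² n) of the n² pairs, so many pairs fit. Group them into
-- K + 1 blocks of L cells. Disjoint cells lie in X independently, each with
-- probability p^s ≥ W^(−s), so by Bernoulli's inequality a block without a
-- cell inside X has probability at most 2^(−(cW + T)); a union bound over all
-- b, all padded N and all blocks (at most 2^(cW) events) leaves a failure
-- probability of 2^(−T). If every block has a cell inside X, a set U with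
-- |U| ≤ n^(1−μ) ≤ K meets at most K of the disjoint cells, so some block has a
-- cell inside X ∖ U, and its pair yields the required x, y, z. Here
-- T = ⌊n^(1/R)⌋ and W = T + 1 for an R depending on Δ and the denominator of μ,
-- and ρ₀ = 1/R turns p ≥ n^(−ρ) into p W ≥ 1.

module Submission where

open import Defs
open import Data.Nat as ℕ using (ℕ; zero; suc)
import Data.Nat.Properties as ℕ
open import Data.Fin using (Fin)
open import Data.List using (List)
open import Data.Rational using (ℚ)
open import Relation.Binary.PropositionalEquality

module Rationals where

  open import Data.Integer as ℤ using (+_)
  import Data.Integer.Properties as ℤ
  open import Data.Rational using (0ℚ; 1ℚ; ½; _+_; _*_; _-_; -_; _/_; _≤_; mkℚ; nonNegative)
  open import Data.Rational.Properties
  open import Data.Rational.Solver using (module +-*-Solver)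
  open +-*-Solver
  open import Algebra.Bundles using (CommutativeMonoid)
  open import Algebra.Properties.CommutativeSemigroup (CommutativeMonoid.commutativeSemigroup *-1-commutativeMonoid)
    using (interchange)
  import Data.Nat.Coprimality as Coprime
  open import Relation.Nullary using (yes; no)
  open import Data.Empty using (⊥-elim)

  0≤1 : 0ℚ ≤ 1ℚ
  0≤1 = nonNegative⁻¹ 1ℚ

  *-nonNeg : ∀ {p q} → 0ℚ ≤ p → 0ℚ ≤ q → 0ℚ ≤ p * q
  *-nonNeg {p} {q} 0≤p 0≤q =
    nonNegative⁻¹ _ {{nonNeg*nonNeg⇒nonNeg p {{nonNegative 0≤p}} q {{nonNegative 0≤q}}}}

  *-monoˡ-≤ : ∀ {r p q} → 0ℚ ≤ r → p ≤ q → r * p ≤ r * q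
  *-monoˡ-≤ {r} 0≤r = *-monoˡ-≤-nonNeg r {{nonNegative 0≤r}}

  *-monoʳ-≤ : ∀ {r p q} → 0ℚ ≤ r → p ≤ q → p * r ≤ q * r
  *-monoʳ-≤ {r} 0≤r = *-monoʳ-≤-nonNeg r {{nonNegative 0≤r}}

  *-mono-≤ : ∀ {p q r s} → 0ℚ ≤ p → 0ℚ ≤ s → p ≤ q → r ≤ s → p * r ≤ q * s
  *-mono-≤ 0≤p 0≤s p≤q r≤s = ≤-trans (*-monoˡ-≤ 0≤p r≤s) (*-monoʳ-≤ 0≤s p≤q)

  p≤1⇒0≤1-p : ∀ {p} → p ≤ 1ℚ → 0ℚ ≤ 1ℚ - p
  p≤1⇒0≤1-p {p} p≤1 = ≤-trans (≤-reflexive (sym (+-inverseʳ p))) (+-monoˡ-≤ (- p) p≤1)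

  -‿antimonoʳ-≤ : ∀ r {p q} → p ≤ q → r - q ≤ r - p
  -‿antimonoʳ-≤ r p≤q = +-monoʳ-≤ r (neg-antimono-≤ p≤q)

  p-q≤p : ∀ p {q} → 0ℚ ≤ q → p - q ≤ p
  p-q≤p p 0≤q = ≤-trans (-‿antimonoʳ-≤ p 0≤q) (≤-reflexive (+-identityʳ p))

  p≤p+q : ∀ {p q} → 0ℚ ≤ q → p ≤ p + q
  p≤p+q {p} 0≤q = ≤-trans (≤-reflexive (sym (+-identityʳ p))) (+-monoʳ-≤ p 0≤q)

  p+q≡1⇒q≡1-p : ∀ {p q} → p + q ≡ 1ℚ → q ≡ 1ℚ - p
  p+q≡1⇒q≡1-p {p} {q} eq = trans (solve 2 (λ p q → q := (p :+ q) :- p) refl p q) (cong (_- p) eq)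

  fromℕ : ℕ → ℚ
  fromℕ m = + m / 1

  fromℕ≡mkℚ : ∀ m → fromℕ m ≡ mkℚ (+ m) 0 (Coprime.sym (Coprime.1-coprimeTo m))
  fromℕ≡mkℚ m = normalize-coprime _

  fromℕ-+ : ∀ a b → fromℕ (a ℕ.+ b) ≡ fromℕ a + fromℕ b
  fromℕ-+ a b = trans (/-cong numerators refl) (sym (cong₂ _+_ (fromℕ≡mkℚ a) (fromℕ≡mkℚ b)))
    where
    numerators : + (a ℕ.+ b) ≡ + a ℤ.* + 1 ℤ.+ + b ℤ.* + 1
    numerators = trans (ℤ.pos-+ a b) (sym (cong₂ ℤ._+_ (ℤ.*-identityʳ (+ a)) (ℤ.*-identityʳ (+ b))))

  fromℕ-* : ∀ a b → fromℕ (a ℕ.* b) ≡ fromℕ a * fromℕ b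
  fromℕ-* a b = trans (/-cong (ℤ.pos-* a b) refl) (sym (cong₂ _*_ (fromℕ≡mkℚ a) (fromℕ≡mkℚ b)))

  fromℕ-^ : ∀ a k → fromℕ (a ℕ.^ k) ≡ fromℕ a ^ℚ k
  fromℕ-^ a zero    = refl
  fromℕ-^ a (suc k) = trans (fromℕ-* a (a ℕ.^ k)) (cong (fromℕ a *_) (fromℕ-^ a k))

  fromℕ-nonNeg : ∀ a → 0ℚ ≤ fromℕ a
  fromℕ-nonNeg a = nonNegative⁻¹ _ {{normalize-nonNeg a 1}}

  fromℕ-mono-≤ : ∀ {a b} → a ℕ.≤ b → fromℕ a ≤ fromℕ b
  fromℕ-mono-≤ {a} {b} a≤b = begin
    fromℕ a                     ≤⟨ p≤p+q (fromℕ-nonNeg (b ℕ.∸ a)) ⟩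
    fromℕ a + fromℕ (b ℕ.∸ a)   ≡⟨ fromℕ-+ a (b ℕ.∸ a) ⟨
    fromℕ (a ℕ.+ (b ℕ.∸ a))     ≡⟨ cong fromℕ (ℕ.m+[n∸m]≡n a≤b) ⟩
    fromℕ b                     ∎
    where open ≤-Reasoning

  ^-nonNeg : ∀ {p} k → 0ℚ ≤ p → 0ℚ ≤ p ^ℚ k
  ^-nonNeg zero    _   = 0≤1
  ^-nonNeg (suc k) 0≤p = *-nonNeg 0≤p (^-nonNeg k 0≤p)

  ^-≤1 : ∀ {p} k → 0ℚ ≤ p → p ≤ 1ℚ → p ^ℚ k ≤ 1ℚ
  ^-≤1 zero    _   _   = ≤-refl
  ^-≤1 (suc k) 0≤p p≤1 = ≤-trans (*-mono-≤ 0≤p 0≤1 p≤1 (^-≤1 k 0≤p p≤1)) (≤-reflexive (*-identityˡ 1ℚ))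

  1≤^ : ∀ {x} k → 1ℚ ≤ x → 1ℚ ≤ x ^ℚ k
  1≤^ zero    _   = ≤-refl
  1≤^ (suc k) 1≤x =
    ≤-trans (≤-reflexive (sym (*-identityˡ 1ℚ))) (*-mono-≤ 0≤1 (≤-trans 0≤1 (1≤^ k 1≤x)) 1≤x (1≤^ k 1≤x))

  ^-monoˡ-≤ : ∀ {p q} k → 0ℚ ≤ p → p ≤ q → p ^ℚ k ≤ q ^ℚ k
  ^-monoˡ-≤ zero    _   _   = ≤-refl
  ^-monoˡ-≤ (suc k) 0≤p p≤q = *-mono-≤ 0≤p (^-nonNeg k (≤-trans 0≤p p≤q)) p≤q (^-monoˡ-≤ k 0≤p p≤q)

  ^-monoʳ-≤ : ∀ {x a b} → 1ℚ ≤ x → a ℕ.≤ b → x ^ℚ a ≤ x ^ℚ b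
  ^-monoʳ-≤ {b = b} 1≤x ℕ.z≤n       = 1≤^ b 1≤x
  ^-monoʳ-≤         1≤x (ℕ.s≤s a≤b) = *-monoˡ-≤ (≤-trans 0≤1 1≤x) (^-monoʳ-≤ 1≤x a≤b)

  ^-antimonoʳ-≤ : ∀ {p a b} → 0ℚ ≤ p → p ≤ 1ℚ → a ℕ.≤ b → p ^ℚ b ≤ p ^ℚ a
  ^-antimonoʳ-≤ {b = b} 0≤p p≤1 ℕ.z≤n       = ^-≤1 b 0≤p p≤1
  ^-antimonoʳ-≤         0≤p p≤1 (ℕ.s≤s a≤b) = *-monoˡ-≤ 0≤p (^-antimonoʳ-≤ 0≤p p≤1 a≤b)

  ^-zeroˡ : ∀ k → 1ℚ ^ℚ k ≡ 1ℚ
  ^-zeroˡ zero    = refl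
  ^-zeroˡ (suc k) = trans (*-identityˡ _) (^-zeroˡ k)

  ^-distribˡ-+-* : ∀ p a b → p ^ℚ (a ℕ.+ b) ≡ p ^ℚ a * p ^ℚ b
  ^-distribˡ-+-* p zero    b = sym (*-identityˡ _)
  ^-distribˡ-+-* p (suc a) b = trans (cong (p *_) (^-distribˡ-+-* p a b)) (sym (*-assoc p _ _))

  ^-*-assoc : ∀ p a b → (p ^ℚ a) ^ℚ b ≡ p ^ℚ (a ℕ.* b)
  ^-*-assoc p a zero    = cong (p ^ℚ_) (sym (ℕ.*-zeroʳ a))
  ^-*-assoc p a (suc b) = begin
    p ^ℚ a * (p ^ℚ a) ^ℚ b    ≡⟨ cong (p ^ℚ a *_) (^-*-assoc p a b) ⟩
    p ^ℚ a * p ^ℚ (a ℕ.* b)   ≡⟨ ^-distribˡ-+-* p a (a ℕ.* b) ⟨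
    p ^ℚ (a ℕ.+ a ℕ.* b)      ≡⟨ cong (p ^ℚ_) (ℕ.*-suc a b) ⟨
    p ^ℚ (a ℕ.* suc b)        ∎
    where open ≡-Reasoning

  ^-distribʳ-* : ∀ p q k → (p * q) ^ℚ k ≡ p ^ℚ k * q ^ℚ k
  ^-distribʳ-* p q zero    = refl
  ^-distribʳ-* p q (suc k) = trans (cong ((p * q) *_) (^-distribʳ-* p q k)) (interchange p q (p ^ℚ k) (q ^ℚ k))

  1≤x^[1+k]⇒1≤x : ∀ {x} k → 0ℚ ≤ x → 1ℚ ≤ x ^ℚ suc k → 1ℚ ≤ x
  1≤x^[1+k]⇒1≤x {x} k 0≤x 1≤x^[1+k] with 1ℚ ≤? x
  ... | yes 1≤x = 1≤x
  ... | no  1≰x = ⊥-elim (<-irrefl refl (≤-<-trans 1≤x^[1+k] (≤-<-trans x^[1+k]≤x x<1)))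
    where
    x<1 = ≰⇒> 1≰x
    x^[1+k]≤x = ≤-trans (*-monoˡ-≤ 0≤x (^-≤1 k 0≤x (<⇒≤ x<1))) (≤-reflexive (*-identityʳ x))

  bernoulli : ∀ q m → 0ℚ ≤ q → q ≤ 1ℚ → (1ℚ - q) ^ℚ m * (1ℚ + q * fromℕ m) ≤ 1ℚ
  bernoulli q zero    _   _   =
    ≤-reflexive (solve 1 (λ q → con 1ℚ :* (con 1ℚ :+ q :* con 0ℚ) := con 1ℚ) refl q)
  bernoulli q (suc m) 0≤q q≤1 = begin
    (1ℚ - q) ^ℚ suc m * (1ℚ + q * fromℕ (suc m))  ≡⟨ cong (λ t → (1ℚ - q) * a * (1ℚ + q * t)) (fromℕ-+ 1 m) ⟩
    (1ℚ - q) * a * (1ℚ + q * (1ℚ + k))             ≡⟨ step ⟩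
    a * (1ℚ + q * k) - a * (q * q) * (k + 1ℚ)      ≤⟨ p-q≤p _ 0≤loss ⟩
    a * (1ℚ + q * k)                               ≤⟨ bernoulli q m 0≤q q≤1 ⟩
    1ℚ                                             ∎
    where
    open ≤-Reasoning
    a = (1ℚ - q) ^ℚ m
    k = fromℕ m
    step : (1ℚ - q) * a * (1ℚ + q * (1ℚ + k)) ≡ a * (1ℚ + q * k) - a * (q * q) * (k + 1ℚ)
    step = solve 3 (λ q a k → (con 1ℚ :- q) :* a :* (con 1ℚ :+ q :* (con 1ℚ :+ k))
                           := a :* (con 1ℚ :+ q :* k) :- a :* (q :* q) :* (k :+ con 1ℚ)) refl q a k
    0≤loss : 0ℚ ≤ a * (q * q) * (k + 1ℚ)
    0≤loss = *-nonNeg (*-nonNeg (^-nonNeg m (p≤1⇒0≤1-p q≤1)) (*-nonNeg 0≤q 0≤q))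
                      (≤-trans (fromℕ-nonNeg m) (p≤p+q 0≤1))

  bernoulli-½ : ∀ q m → 0ℚ ≤ q → q ≤ 1ℚ → 1ℚ ≤ q * fromℕ m → (1ℚ - q) ^ℚ m ≤ ½
  bernoulli-½ q m 0≤q q≤1 1≤qm = begin
    a                    ≡⟨ solve 1 (λ a → a := (a :* (con 1ℚ :+ con 1ℚ)) :* con ½) refl a ⟩
    (a * (1ℚ + 1ℚ)) * ½  ≤⟨ *-monoʳ-≤ (nonNegative⁻¹ ½) a[1+1]≤1 ⟩
    1ℚ * ½               ≡⟨ *-identityˡ ½ ⟩
    ½                    ∎
    where
    open ≤-Reasoning
    a = (1ℚ - q) ^ℚ m
    a[1+1]≤1 : a * (1ℚ + 1ℚ) ≤ 1ℚ
    a[1+1]≤1 = ≤-trans (*-monoˡ-≤ (^-nonNeg m (p≤1⇒0≤1-p q≤1)) (+-monoʳ-≤ 1ℚ 1≤qm)) (bernoulli q m 0≤q q≤1)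

  bernoulli-½^ : ∀ q m j → 0ℚ ≤ q → q ≤ 1ℚ → 1ℚ ≤ q * fromℕ m → (1ℚ - q) ^ℚ (m ℕ.* j) ≤ ½ ^ℚ j
  bernoulli-½^ q m j 0≤q q≤1 1≤qm = ≤-trans (≤-reflexive (sym (^-*-assoc (1ℚ - q) m j)))
    (^-monoˡ-≤ j (^-nonNeg m (p≤1⇒0≤1-p q≤1)) (bernoulli-½ q m 0≤q q≤1 1≤qm))

  2^a*½^[a+t]≡½^t : ∀ a t → fromℕ (2 ℕ.^ a) * ½ ^ℚ (a ℕ.+ t) ≡ ½ ^ℚ t
  2^a*½^[a+t]≡½^t a t = begin
    fromℕ (2 ℕ.^ a) * ½ ^ℚ (a ℕ.+ t)   ≡⟨ cong₂ _*_ (fromℕ-^ 2 a) (^-distribˡ-+-* ½ a t) ⟩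
    fromℕ 2 ^ℚ a * (½ ^ℚ a * ½ ^ℚ t)   ≡⟨ *-assoc (fromℕ 2 ^ℚ a) (½ ^ℚ a) (½ ^ℚ t) ⟨
    fromℕ 2 ^ℚ a * ½ ^ℚ a * ½ ^ℚ t     ≡⟨ cong (_* ½ ^ℚ t) (^-distribʳ-* (fromℕ 2) ½ a) ⟨
    (fromℕ 2 * ½) ^ℚ a * ½ ^ℚ t        ≡⟨ cong (_* ½ ^ℚ t) (^-zeroˡ a) ⟩
    1ℚ * ½ ^ℚ t                        ≡⟨ *-identityˡ (½ ^ℚ t) ⟩
    ½ ^ℚ t                             ∎
    where open ≡-Reasoning

module Lists where

  open import Data.Nat.ListAction using (sum)
  open import Data.Nat.ListAction.Properties using (sum-++)
  open import Data.Fin as Fin using (Fin)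
  import Data.Fin.Properties as Fin
  open import Data.List
    using (List; []; _∷_; map; _++_; length; allFin; lookup; take; drop; concat; concatMap; cartesianProductWith)
  open import Data.List.Properties
    using (length-map; length-++; length-tabulate; length-take; length-drop; map-++; take++drop≡id)
  open import Data.List.Relation.Unary.All using (All; []; _∷_)
  open import Data.List.Relation.Unary.Any as Any using (here; there)
  open import Data.List.Relation.Unary.Any.Properties using (lookup-index)
  open import Data.List.Membership.Propositional using (_∈_; _∉_)
  open import Data.List.Membership.Propositional.Properties
    using (∈-map⁺; ∈-++⁺ˡ; ∈-++⁺ʳ; ∈-allFin; ∈-cartesianProductWith⁺)
  import Data.List.Membership.DecPropositional as DecMembership
  open import Data.Vec as Vec using (Vec)
  open import Data.Product using (∃; _×_; _,_; uncurry)
  open import Relation.Nullary using (yes; no)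
  open import Data.Empty using (⊥-elim)

  private
    variable
      A B C : Set

  length-cartesianProductWith : ∀ (f : A → B → C) xs ys →
    length (cartesianProductWith f xs ys) ≡ length xs ℕ.* length ys
  length-cartesianProductWith f []       ys = refl
  length-cartesianProductWith f (x ∷ xs) ys =
    trans (length-++ (map (f x) ys)) (cong₂ ℕ._+_ (length-map (f x) ys) (length-cartesianProductWith f xs ys))

  length-concatMap : ∀ (f : A → List B) k xs → (∀ x → length (f x) ≡ k) →
    length (concatMap f xs) ≡ length xs ℕ.* k
  length-concatMap f k []       _       = refl
  length-concatMap f k (x ∷ xs) length≡ =
    trans (length-++ (f x)) (cong₂ ℕ._+_ (length≡ x) (length-concatMap f k xs length≡))

  allVecs : ∀ n k → List (Vec (Fin n) k)
  allVecs n zero    = Vec.[] ∷ []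
  allVecs n (suc k) = cartesianProductWith Vec._∷_ (allFin n) (allVecs n k)

  length-allVecs : ∀ n k → length (allVecs n k) ≡ n ℕ.^ k
  length-allVecs n zero    = refl
  length-allVecs n (suc k) = trans (length-cartesianProductWith Vec._∷_ (allFin n) (allVecs n k))
    (cong₂ ℕ._*_ (length-tabulate {n = n} (λ i → i)) (length-allVecs n k))

  ∈-allVecs : ∀ {n k} (v : Vec (Fin n) k) → v ∈ allVecs n k
  ∈-allVecs Vec.[]       = here refl
  ∈-allVecs (a Vec.∷ v) = ∈-cartesianProductWith⁺ Vec._∷_ (∈-allFin a) (∈-allVecs v)

  missing : ∀ {N} (xs : List (Fin N)) → length xs ℕ.< N → ∃ λ i → i ∉ xs
  missing {N} xs len<N with Fin.all? (λ i → DecMembership._∈?_ Fin._≟_ i xs)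
  ... | no ¬all = Fin.¬∀⟶∃¬ N (_∈ xs) (λ i → DecMembership._∈?_ Fin._≟_ i xs) ¬all
  ... | yes all with Fin.pigeonhole len<N (λ i → Any.index (all i))
  ... | i , j , i<j , same = ⊥-elim (Fin.<⇒≢ i<j (begin
    i                              ≡⟨ lookup-index (all i) ⟩
    lookup xs (Any.index (all i))  ≡⟨ cong (lookup xs) same ⟩
    lookup xs (Any.index (all j))  ≡⟨ lookup-index (all j) ⟨
    j                              ∎))
    where open ≡-Reasoning

  missingPair : ∀ {n} (xs : List (Fin n × Fin n)) → length xs ℕ.< n ℕ.* n → ∃ λ pr → pr ∉ xs
  missingPair {n} xs len<n*n with missing (map codes xs) (subst (ℕ._< n ℕ.* n) (sym (length-map codes xs)) len<n*n)
    where codes = uncurry Fin.combine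
  ... | i , i∉ = Fin.remQuot n i , λ pr∈xs →
    i∉ (subst (_∈ map (uncurry Fin.combine) xs) (Fin.combine-remQuot {n} n i) (∈-map⁺ (uncurry Fin.combine) pr∈xs))

  chunks : ℕ → ℕ → List A → List (List A)
  chunks L zero    xs = []
  chunks L (suc B) xs = take L xs ∷ chunks L B (drop L xs)

  length-chunks : ∀ L B (xs : List A) → length (chunks L B xs) ≡ B
  length-chunks L zero    xs = refl
  length-chunks L (suc B) xs = cong suc (length-chunks L B (drop L xs))

  private
    length-drop-chunk : ∀ L B (xs : List A) → length xs ≡ suc B ℕ.* L → length (drop L xs) ≡ B ℕ.* L
    length-drop-chunk L B xs len = trans (length-drop L xs) (trans (cong (ℕ._∸ L) len) (ℕ.m+n∸m≡n L (B ℕ.* L)))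

  concat-chunks : ∀ L B (xs : List A) → length xs ≡ B ℕ.* L → concat (chunks L B xs) ≡ xs
  concat-chunks L zero    []       _   = refl
  concat-chunks L (suc B) xs       len =
    trans (cong (take L xs ++_) (concat-chunks L B (drop L xs) (length-drop-chunk L B xs len))) (take++drop≡id L xs)

  length-∈-chunks : ∀ L B (xs : List A) → length xs ≡ B ℕ.* L → All (λ ys → length ys ≡ L) (chunks L B xs)
  length-∈-chunks L zero    xs len = []
  length-∈-chunks L (suc B) xs len =
    trans (length-take L xs) (ℕ.m≤n⇒m⊓n≡m (ℕ.≤-trans (ℕ.m≤m+n L (B ℕ.* L)) (ℕ.≤-reflexive (sym len))))
    ∷ length-∈-chunks L B (drop L xs) (length-drop-chunk L B xs len)

  All-chunks : ∀ (P : List A → Set) L B xs →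
    (∀ {ys} → P ys → P (take L ys)) → (∀ {ys} → P ys → P (drop L ys)) → P xs → All P (chunks L B xs)
  All-chunks P L zero    xs P-take P-drop Pxs = []
  All-chunks P L (suc B) xs P-take P-drop Pxs = P-take Pxs ∷ All-chunks P L B (drop L xs) P-take P-drop (P-drop Pxs)

  ∈⇒≤sum : ∀ (f : A → ℕ) {a} xs → a ∈ xs → f a ℕ.≤ sum (map f xs)
  ∈⇒≤sum f (x ∷ xs) (here refl) = ℕ.m≤m+n (f x) _
  ∈⇒≤sum f (x ∷ xs) (there a∈)  = ℕ.≤-trans (∈⇒≤sum f xs a∈) (ℕ.m≤n+m _ (f x))

  blocks-pigeonhole : ∀ (f : A → ℕ) (P : A → Set) (bs : List (List A)) →
    All (λ ys → ∃ λ a → a ∈ ys × P a) bs → sum (map f (concat bs)) ℕ.< length bs →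
    ∃ λ a → a ∈ concat bs × P a × f a ≡ 0
  blocks-pigeonhole f P (ys ∷ bs) ((a , a∈ys , Pa) ∷ marked) weight< with f a ℕ.≟ 0
  ... | yes fa≡0 = a , ∈-++⁺ˡ a∈ys , Pa , fa≡0
  ... | no  fa≢0 with blocks-pigeonhole f P bs marked weight<′
    where
    weight<′ : sum (map f (concat bs)) ℕ.< length bs
    weight<′ = ℕ.≤-pred (begin-strict
      1 ℕ.+ sum (map f (concat bs))               ≤⟨ ℕ.+-monoˡ-≤ _ (ℕ.≤-trans (ℕ.n≢0⇒n>0 fa≢0) (∈⇒≤sum f ys a∈ys)) ⟩
      sum (map f ys) ℕ.+ sum (map f (concat bs))  ≡⟨ sum-++ (map f ys) _ ⟨
      sum (map f ys ++ map f (concat bs))         ≡⟨ cong sum (map-++ f ys (concat bs)) ⟨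
      sum (map f (ys ++ concat bs))               <⟨ weight< ⟩
      suc (length bs)                             ∎)
      where open ℕ.≤-Reasoning
  ... | a′ , a′∈ , Pa′ , fa′≡0 = a′ , ∈-++⁺ʳ ys a′∈ , Pa′ , fa′≡0

module Subsets where

  open import Data.Nat.ListAction using (sum)
  open import Data.Bool using (true; false)
  open import Data.Fin using (Fin; zero; suc)
  open import Data.Fin.Subset using (Subset; ⁅_⁆; _∪_; _∩_; ⊥; ∣_∣; ⋃; _∈_; _∉_)
  open import Data.Fin.Subset.Properties
    using (x∈p∪q⁺; x∈p∪q⁻; x∈p∩q⁺; x∈⁅x⁆; x∈⁅y⁆⇒x≡y; ∣⁅x⁆∣≡1; ∉⊥; ∣⊥∣≡0; p⊆q⇒∣p∣≤∣q∣)
  open import Data.List using (List; []; _∷_; map; length)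
  open import Data.List.Properties using (length-map)
  open import Data.List.Relation.Unary.All using (All; []; _∷_)
  open import Data.List.Relation.Unary.AllPairs using (AllPairs; []; _∷_)
  open import Data.List.Relation.Unary.Any using (here; there)
  open import Data.List.Membership.Propositional using () renaming (_∈_ to _∈ₗ_)
  open import Data.List.Membership.Propositional.Properties using (∈-map⁺)
  open import Data.Vec as Vec using (Vec; []; _∷_; here; there; padRight)
  open import Data.Vec.Properties using (toList∘fromList)
  open import Data.Product using (_,_)
  open import Data.Sum using (inj₁; inj₂)
  open import Data.Empty using (⊥-elim) renaming (⊥ to Empty)

  Disjoint : ∀ {n} → Subset n → Subset n → Set
  Disjoint {n} A B = ∀ {i : Fin n} → i ∈ A → i ∈ B → Empty

  disjoint-tail : ∀ {n a b} {A B : Subset n} → Disjoint (a ∷ A) (b ∷ B) → Disjoint A B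
  disjoint-tail A#B i∈A i∈B = A#B (there i∈A) (there i∈B)

  disjoint-⋃ : ∀ {n} {T : Subset n} Ts → All (Disjoint T) Ts → Disjoint T (⋃ Ts)
  disjoint-⋃ []       []            i∈T i∈⊥ = ∉⊥ i∈⊥
  disjoint-⋃ (U ∷ Us) (T#U ∷ T#Us) i∈T i∈⋃ with x∈p∪q⁻ U (⋃ Us) i∈⋃
  ... | inj₁ i∈U  = T#U i∈T i∈U
  ... | inj₂ i∈Us = disjoint-⋃ Us T#Us i∈T i∈Us

  toSubset : ∀ {n} → List (Fin n) → Subset n
  toSubset []       = ⊥
  toSubset (a ∷ as) = ⁅ a ⁆ ∪ toSubset as

  ∈-toSubset⁺ : ∀ {n} {i : Fin n} {as} → i ∈ₗ as → i ∈ toSubset as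
  ∈-toSubset⁺ {as = a ∷ as} (here refl) = x∈p∪q⁺ (inj₁ (x∈⁅x⁆ a))
  ∈-toSubset⁺ {as = a ∷ as} (there i∈)  = x∈p∪q⁺ {p = ⁅ a ⁆} (inj₂ (∈-toSubset⁺ i∈))

  ∈-toSubset⁻ : ∀ {n} {i : Fin n} as → i ∈ toSubset as → i ∈ₗ as
  ∈-toSubset⁻ []       i∈ = ⊥-elim (∉⊥ i∈)
  ∈-toSubset⁻ (a ∷ as) i∈ with x∈p∪q⁻ ⁅ a ⁆ (toSubset as) i∈
  ... | inj₁ i∈⁅a⁆ = here (x∈⁅y⁆⇒x≡y a i∈⁅a⁆)
  ... | inj₂ i∈as  = there (∈-toSubset⁻ as i∈as)

  ∣p∪q∣≤∣p∣+∣q∣ : ∀ {n} (p q : Subset n) → ∣ p ∪ q ∣ ℕ.≤ ∣ p ∣ ℕ.+ ∣ q ∣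
  ∣p∪q∣≤∣p∣+∣q∣ []          []          = ℕ.z≤n
  ∣p∪q∣≤∣p∣+∣q∣ (true ∷ p)  (true ∷ q)  =
    ℕ.s≤s (ℕ.≤-trans (ℕ.m≤n⇒m≤1+n (∣p∪q∣≤∣p∣+∣q∣ p q)) (ℕ.≤-reflexive (sym (ℕ.+-suc ∣ p ∣ ∣ q ∣))))
  ∣p∪q∣≤∣p∣+∣q∣ (true ∷ p)  (false ∷ q) = ℕ.s≤s (∣p∪q∣≤∣p∣+∣q∣ p q)
  ∣p∪q∣≤∣p∣+∣q∣ (false ∷ p) (true ∷ q)  =
    ℕ.≤-trans (ℕ.s≤s (∣p∪q∣≤∣p∣+∣q∣ p q)) (ℕ.≤-reflexive (sym (ℕ.+-suc ∣ p ∣ ∣ q ∣)))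
  ∣p∪q∣≤∣p∣+∣q∣ (false ∷ p) (false ∷ q) = ∣p∪q∣≤∣p∣+∣q∣ p q

  ∣toSubset∣≤length : ∀ {n} (as : List (Fin n)) → ∣ toSubset as ∣ ℕ.≤ length as
  ∣toSubset∣≤length {n} []       = ℕ.≤-reflexive (∣⊥∣≡0 n)
  ∣toSubset∣≤length     (a ∷ as) = ℕ.≤-trans (∣p∪q∣≤∣p∣+∣q∣ ⁅ a ⁆ (toSubset as))
    (ℕ.≤-trans (ℕ.≤-reflexive (cong (ℕ._+ ∣ toSubset as ∣) (∣⁅x⁆∣≡1 a))) (ℕ.s≤s (∣toSubset∣≤length as)))

  ∣[p∪q]∩r∣ : ∀ {n} (p q r : Subset n) → Disjoint p q → ∣ (p ∪ q) ∩ r ∣ ≡ ∣ p ∩ r ∣ ℕ.+ ∣ q ∩ r ∣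
  ∣[p∪q]∩r∣ []          []          []          _   = refl
  ∣[p∪q]∩r∣ (true ∷ p)  (true ∷ q)  (_ ∷ r)     p#q = ⊥-elim (p#q here here)
  ∣[p∪q]∩r∣ (true ∷ p)  (false ∷ q) (true ∷ r)  p#q = cong suc (∣[p∪q]∩r∣ p q r (disjoint-tail p#q))
  ∣[p∪q]∩r∣ (true ∷ p)  (false ∷ q) (false ∷ r) p#q = ∣[p∪q]∩r∣ p q r (disjoint-tail p#q)
  ∣[p∪q]∩r∣ (false ∷ p) (true ∷ q)  (true ∷ r)  p#q =
    trans (cong suc (∣[p∪q]∩r∣ p q r (disjoint-tail p#q))) (sym (ℕ.+-suc _ _))
  ∣[p∪q]∩r∣ (false ∷ p) (true ∷ q)  (false ∷ r) p#q = ∣[p∪q]∩r∣ p q r (disjoint-tail p#q)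
  ∣[p∪q]∩r∣ (false ∷ p) (false ∷ q) (_ ∷ r)     p#q = ∣[p∪q]∩r∣ p q r (disjoint-tail p#q)

  ∣⊥∩r∣≡0 : ∀ {n} (r : Subset n) → ∣ ⊥ ∩ r ∣ ≡ 0
  ∣⊥∩r∣≡0 []      = refl
  ∣⊥∩r∣≡0 (_ ∷ r) = ∣⊥∩r∣≡0 r

  sum-∣∩∣ : ∀ {n} (r : Subset n) Ts → AllPairs Disjoint Ts →
    sum (map (λ T → ∣ T ∩ r ∣) Ts) ≡ ∣ ⋃ Ts ∩ r ∣
  sum-∣∩∣ r []       []            = sym (∣⊥∩r∣≡0 r)
  sum-∣∩∣ r (T ∷ Ts) (T#Ts ∷ Ts#) =
    trans (cong (∣ T ∩ r ∣ ℕ.+_) (sum-∣∩∣ r Ts Ts#)) (sym (∣[p∪q]∩r∣ T (⋃ Ts) r (disjoint-⋃ Ts T#Ts)))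

  x∈p⇒0<∣p∣ : ∀ {n} {i : Fin n} {p} → i ∈ p → 0 ℕ.< ∣ p ∣
  x∈p⇒0<∣p∣ {i = i} {p} i∈p = ℕ.≤-trans (ℕ.≤-reflexive (sym (∣⁅x⁆∣≡1 i)))
    (p⊆q⇒∣p∣≤∣q∣ (λ j∈⁅i⁆ → subst (_∈ p) (sym (x∈⁅y⁆⇒x≡y i j∈⁅i⁆)) i∈p))

  ∣p∩q∣≡0⇒x∈p⇒x∉q : ∀ {n} {i : Fin n} {p q} → ∣ p ∩ q ∣ ≡ 0 → i ∈ p → i ∉ q
  ∣p∩q∣≡0⇒x∈p⇒x∉q ∣p∩q∣≡0 i∈p i∈q =
    ℕ.<-irrefl (sym ∣p∩q∣≡0) (x∈p⇒0<∣p∣ (x∈p∩q⁺ (i∈p , i∈q)))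

  elements : ∀ {n} → Subset n → List (Fin n)
  elements []          = []
  elements (true ∷ p)  = zero ∷ map suc (elements p)
  elements (false ∷ p) = map suc (elements p)

  length-elements : ∀ {n} (p : Subset n) → length (elements p) ≡ ∣ p ∣
  length-elements []          = refl
  length-elements (true ∷ p)  = cong suc (trans (length-map suc (elements p)) (length-elements p))
  length-elements (false ∷ p) = trans (length-map suc (elements p)) (length-elements p)

  ∈-elements : ∀ {n} {i : Fin n} (p : Subset n) → i ∈ p → i ∈ₗ elements p
  ∈-elements (true ∷ p)  here       = here refl
  ∈-elements (true ∷ p)  (there i∈) = there (∈-map⁺ suc (∈-elements p i∈))
  ∈-elements (false ∷ p) (there i∈) = ∈-map⁺ suc (∈-elements p i∈)

  private
    ∈-padRight : ∀ {A : Set} {m k} (m≤k : m ℕ.≤ k) a (xs : Vec A m) {i} →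
      i ∈ₗ Vec.toList xs → i ∈ₗ Vec.toList (padRight m≤k a xs)
    ∈-padRight (ℕ.s≤s m≤k) a (x ∷ xs) (here eq)  = here eq
    ∈-padRight (ℕ.s≤s m≤k) a (x ∷ xs) (there i∈) = there (∈-padRight m≤k a xs i∈)

    length-elements≤ : ∀ {n Δ} (p : Subset n) → ∣ p ∣ ℕ.≤ Δ → length (elements p) ℕ.≤ Δ
    length-elements≤ p = subst (ℕ._≤ _) (sym (length-elements p))

  padding : ∀ {n Δ} (d : Fin n) (p : Subset n) → ∣ p ∣ ℕ.≤ Δ → Vec (Fin n) Δ
  padding d p ∣p∣≤Δ = padRight (length-elements≤ p ∣p∣≤Δ) d (Vec.fromList (elements p))

  ∈-padding : ∀ {n Δ} (d : Fin n) (p : Subset n) (∣p∣≤Δ : ∣ p ∣ ℕ.≤ Δ) {i} →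
    i ∈ p → i ∈ₗ Vec.toList (padding d p ∣p∣≤Δ)
  ∈-padding d p ∣p∣≤Δ i∈p = ∈-padRight (length-elements≤ p ∣p∣≤Δ) d (Vec.fromList (elements p))
    (subst (_ ∈ₗ_) (sym (toList∘fromList (elements p))) (∈-elements p i∈p))

module RandomSubsets where

  open import Data.Bool using (Bool; true; false; if_then_else_; _∧_; _∨_; not)
  open import Data.Bool.Properties using (∧-comm)
  open import Data.Vec using ([]; _∷_; here; there; lookup)
  open import Data.List using (List; []; _∷_; map; _++_; foldr; length)
  open import Data.List.Relation.Unary.All using (All; []; _∷_)
  open import Data.List.Relation.Unary.AllPairs using (AllPairs; []; _∷_)
  open import Data.List.Relation.Unary.Any using (here; there)
  open import Data.List.Membership.Propositional using () renaming (_∈_ to _∈ₗ_)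
  open import Data.Fin.Subset using (Subset; ∣_∣; _∈_; _⊆_; ⋃)
  open import Data.Fin.Subset.Properties using (∣p∣≤n; _⊆?_; p⊆p∪q; q⊆p∪q)
  open import Data.Rational using (0ℚ; 1ℚ; _+_; _*_; _-_; _≤_)
  open import Data.Rational.Properties
  open import Data.Rational.Solver using (module +-*-Solver)
  open +-*-Solver
  open import Algebra.Bundles using (CommutativeMonoid)
  open import Algebra.Properties.CommutativeSemigroup (CommutativeMonoid.commutativeSemigroup *-1-commutativeMonoid)
    using (x∙yz≈y∙xz)
  open import Data.Empty using (⊥-elim)
  open import Data.Product using (∃; _×_; _,_)
  open import Function using (_∘_)
  open import Relation.Nullary using (yes; does)
  open Rationals
  open Subsets using (Disjoint; disjoint-tail; disjoint-⋃)

  Event : ℕ → Set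
  Event n = Subset n → Bool

  𝟙 : Bool → ℚ
  𝟙 b = if b then 1ℚ else 0ℚ

  mix : ℚ → ℚ → ℚ → ℚ
  mix p a b = p * a + (1ℚ - p) * b

  mix-mono-≤ : ∀ {p a a′ b b′} → 0ℚ ≤ p → p ≤ 1ℚ → a ≤ a′ → b ≤ b′ → mix p a b ≤ mix p a′ b′
  mix-mono-≤ 0≤p p≤1 a≤a′ b≤b′ = +-mono-≤ (*-monoˡ-≤ 0≤p a≤a′) (*-monoˡ-≤ (p≤1⇒0≤1-p p≤1) b≤b′)

  mix-+ : ∀ p a b a′ b′ → mix p a b + mix p a′ b′ ≡ mix p (a + a′) (b + b′)
  mix-+ = solve 5 (λ p a b a′ b′ → (p :* a :+ (con 1ℚ :- p) :* b) :+ (p :* a′ :+ (con 1ℚ :- p) :* b′)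
                                 := p :* (a :+ a′) :+ (con 1ℚ :- p) :* (b :+ b′)) refl

  mix-same : ∀ p a → mix p a a ≡ a
  mix-same = solve 2 (λ p a → p :* a :+ (con 1ℚ :- p) :* a := a) refl

  mix-*ʳ : ∀ p a b c → mix p (a * c) (b * c) ≡ mix p a b * c
  mix-*ʳ = solve 4 (λ p a b c → p :* (a :* c) :+ (con 1ℚ :- p) :* (b :* c)
                             := (p :* a :+ (con 1ℚ :- p) :* b) :* c) refl

  private
    sumOver : ∀ {n} → List (Subset n) → (Subset n → ℚ) → ℚ
    sumOver Xs f = foldr (λ X acc → f X + acc) 0ℚ Xs

    sumOver-++ : ∀ {n} (Xs Ys : List (Subset n)) f → sumOver (Xs ++ Ys) f ≡ sumOver Xs f + sumOver Ys f
    sumOver-++ []       Ys f = sym (+-identityˡ _)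
    sumOver-++ (X ∷ Xs) Ys f = trans (cong (f X +_) (sumOver-++ Xs Ys f)) (sym (+-assoc (f X) _ _))

    sumOver-map : ∀ {m n} (g : Subset m → Subset n) Xs f → sumOver (map g Xs) f ≡ sumOver Xs (f ∘ g)
    sumOver-map g []       f = refl
    sumOver-map g (X ∷ Xs) f = cong (f (g X) +_) (sumOver-map g Xs f)

    sumOver-cong : ∀ {n} (Xs : List (Subset n)) {f g} → (∀ X → f X ≡ g X) → sumOver Xs f ≡ sumOver Xs g
    sumOver-cong []       f≗g = refl
    sumOver-cong (X ∷ Xs) f≗g = cong₂ _+_ (f≗g X) (sumOver-cong Xs f≗g)

    sumOver-scale : ∀ {n} (Xs : List (Subset n)) c f → sumOver Xs ((c *_) ∘ f) ≡ c * sumOver Xs f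
    sumOver-scale []       c f = sym (*-zeroʳ c)
    sumOver-scale (X ∷ Xs) c f = trans (cong (c * f X +_) (sumOver-scale Xs c f)) (sym (*-distribˡ-+ c (f X) _))

    term : ∀ {n} → ℚ → Event n → Subset n → ℚ
    term p χ X = if χ X then weight p X else 0ℚ

    term-true : ∀ {n} p χ (X : Subset n) → term p χ (true ∷ X) ≡ p * term p (χ ∘ (true ∷_)) X
    term-true p χ X with χ (true ∷ X)
    ... | true  = *-assoc p _ _
    ... | false = sym (*-zeroʳ p)

    term-false : ∀ {n} p χ (X : Subset n) → term p χ (false ∷ X) ≡ (1ℚ - p) * term p (χ ∘ (false ∷_)) X
    term-false {n} p χ X with χ (false ∷ X)
    ... | true  rewrite ℕ.+-∸-assoc 1 (∣p∣≤n X) =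
      x∙yz≈y∙xz (p ^ℚ ∣ X ∣) (1ℚ - p) ((1ℚ - p) ^ℚ (n ℕ.∸ ∣ X ∣))
    ... | false = sym (*-zeroʳ (1ℚ - p))

  probOf-zero : ∀ p (χ : Event 0) → probOf 0 p χ ≡ 𝟙 (χ [])
  probOf-zero p χ with χ []
  ... | true  = refl
  ... | false = refl

  probOf-suc : ∀ n p (χ : Event (suc n)) →
    probOf (suc n) p χ ≡ mix p (probOf n p (χ ∘ (true ∷_))) (probOf n p (χ ∘ (false ∷_)))
  probOf-suc n p χ = begin
    sumOver (map (true ∷_) Xs ++ map (false ∷_) Xs) (term p χ)
      ≡⟨ sumOver-++ (map (true ∷_) Xs) (map (false ∷_) Xs) (term p χ) ⟩
    sumOver (map (true ∷_) Xs) (term p χ) + sumOver (map (false ∷_) Xs) (term p χ)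
      ≡⟨ cong₂ _+_ (sumOver-map (true ∷_) Xs (term p χ)) (sumOver-map (false ∷_) Xs (term p χ)) ⟩
    sumOver Xs (term p χ ∘ (true ∷_)) + sumOver Xs (term p χ ∘ (false ∷_))
      ≡⟨ cong₂ _+_ (sumOver-cong Xs (term-true p χ)) (sumOver-cong Xs (term-false p χ)) ⟩
    sumOver Xs ((p *_) ∘ term p (χ ∘ (true ∷_))) + sumOver Xs (((1ℚ - p) *_) ∘ term p (χ ∘ (false ∷_)))
      ≡⟨ cong₂ _+_ (sumOver-scale Xs p _) (sumOver-scale Xs (1ℚ - p) _) ⟩
    mix p (probOf n p (χ ∘ (true ∷_))) (probOf n p (χ ∘ (false ∷_))) ∎
    where
    open ≡-Reasoning
    Xs = allSubsets n

  probOf-cong : ∀ n p {χ ψ : Event n} → (∀ X → χ X ≡ ψ X) → probOf n p χ ≡ probOf n p ψ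
  probOf-cong n p χ≗ψ =
    sumOver-cong (allSubsets n) (λ X → cong (λ b → if b then weight p X else 0ℚ) (χ≗ψ X))

  probOf-false : ∀ n p → probOf n p (λ _ → false) ≡ 0ℚ
  probOf-false n p = go (allSubsets n)
    where
    go : (Xs : List (Subset n)) → sumOver Xs (term p (λ _ → false)) ≡ 0ℚ
    go []       = refl
    go (X ∷ Xs) = trans (+-identityˡ _) (go Xs)

  probOf-not : ∀ n p (χ : Event n) → probOf n p χ + probOf n p (not ∘ χ) ≡ 1ℚ
  probOf-not zero p χ = trans (cong₂ _+_ (probOf-zero p χ) (probOf-zero p (not ∘ χ))) (𝟙b+𝟙¬b (χ []))
    where
    𝟙b+𝟙¬b : ∀ b → 𝟙 b + 𝟙 (not b) ≡ 1ℚ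
    𝟙b+𝟙¬b true  = refl
    𝟙b+𝟙¬b false = refl
  probOf-not (suc n) p χ = begin
    probOf (suc n) p χ + probOf (suc n) p (not ∘ χ)
      ≡⟨ cong₂ _+_ (probOf-suc n p χ) (probOf-suc n p (not ∘ χ)) ⟩
    mix p (probOf n p χ₁) (probOf n p χ₀) + mix p (probOf n p (not ∘ χ₁)) (probOf n p (not ∘ χ₀))
      ≡⟨ mix-+ p _ _ _ _ ⟩
    mix p (probOf n p χ₁ + probOf n p (not ∘ χ₁)) (probOf n p χ₀ + probOf n p (not ∘ χ₀))
      ≡⟨ cong₂ (mix p) (probOf-not n p χ₁) (probOf-not n p χ₀) ⟩
    mix p 1ℚ 1ℚ
      ≡⟨ mix-same p 1ℚ ⟩
    1ℚ ∎
    where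
    open ≡-Reasoning
    χ₁ = χ ∘ (true ∷_)
    χ₀ = χ ∘ (false ∷_)

  probOf-not′ : ∀ n p (χ : Event n) → probOf n p (not ∘ χ) ≡ 1ℚ - probOf n p χ
  probOf-not′ n p χ = p+q≡1⇒q≡1-p {probOf n p χ} (probOf-not n p χ)

  probOf-true : ∀ n p → probOf n p (λ _ → true) ≡ 1ℚ
  probOf-true n p = begin
    probOf n p (λ _ → true)                                 ≡⟨ +-identityˡ _ ⟨
    0ℚ + probOf n p (λ _ → true)                            ≡⟨ cong (_+ probOf n p (λ _ → true)) (probOf-false n p) ⟨
    probOf n p (λ _ → false) + probOf n p (λ _ → true)      ≡⟨ probOf-not n p (λ _ → false) ⟩
    1ℚ                                                      ∎
    where open ≡-Reasoning

  probOf-∨ : ∀ n p (χ ψ : Event n) → 0ℚ ≤ p → p ≤ 1ℚ →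
    probOf n p (λ X → χ X ∨ ψ X) ≤ probOf n p χ + probOf n p ψ
  probOf-∨ zero p χ ψ _ _ = begin
    probOf 0 p (λ X → χ X ∨ ψ X)   ≡⟨ probOf-zero p (λ X → χ X ∨ ψ X) ⟩
    𝟙 (χ [] ∨ ψ [])                ≤⟨ 𝟙-∨ (χ []) (ψ []) ⟩
    𝟙 (χ []) + 𝟙 (ψ [])            ≡⟨ cong₂ _+_ (probOf-zero p χ) (probOf-zero p ψ) ⟨
    probOf 0 p χ + probOf 0 p ψ    ∎
    where
    open ≤-Reasoning
    𝟙-∨ : ∀ b c → 𝟙 (b ∨ c) ≤ 𝟙 b + 𝟙 c
    𝟙-∨ true  true  = p≤p+q 0≤1
    𝟙-∨ true  false = ≤-refl
    𝟙-∨ false true  = ≤-refl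
    𝟙-∨ false false = ≤-refl
  probOf-∨ (suc n) p χ ψ 0≤p p≤1 = begin
    probOf (suc n) p (λ X → χ X ∨ ψ X)
      ≡⟨ probOf-suc n p (λ X → χ X ∨ ψ X) ⟩
    mix p (probOf n p (λ X → χ₁ X ∨ ψ₁ X)) (probOf n p (λ X → χ₀ X ∨ ψ₀ X))
      ≤⟨ mix-mono-≤ 0≤p p≤1 (probOf-∨ n p χ₁ ψ₁ 0≤p p≤1) (probOf-∨ n p χ₀ ψ₀ 0≤p p≤1) ⟩
    mix p (probOf n p χ₁ + probOf n p ψ₁) (probOf n p χ₀ + probOf n p ψ₀)
      ≡⟨ mix-+ p _ _ _ _ ⟨
    mix p (probOf n p χ₁) (probOf n p χ₀) + mix p (probOf n p ψ₁) (probOf n p ψ₀)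
      ≡⟨ cong₂ _+_ (probOf-suc n p χ) (probOf-suc n p ψ) ⟨
    probOf (suc n) p χ + probOf (suc n) p ψ ∎
    where
    open ≤-Reasoning
    χ₁ = χ ∘ (true ∷_)
    χ₀ = χ ∘ (false ∷_)
    ψ₁ = ψ ∘ (true ∷_)
    ψ₀ = ψ ∘ (false ∷_)

  DeterminedBy : ∀ {n} → Subset n → Event n → Set
  DeterminedBy {n} A χ = ∀ X Y → (∀ {i} → i ∈ A → lookup X i ≡ lookup Y i) → χ X ≡ χ Y

  private
    determinedBy-tail : ∀ {n} a (A : Subset n) {χ} x →
      DeterminedBy (a ∷ A) χ → DeterminedBy A (χ ∘ (x ∷_))
    determinedBy-tail a A x χ∣aA X Y X≈Y = χ∣aA (x ∷ X) (x ∷ Y) λ where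
      here        → refl
      (there i∈A) → X≈Y i∈A

    determinedBy-head : ∀ {n} (A : Subset n) {χ} →
      DeterminedBy (false ∷ A) χ → ∀ X → χ (true ∷ X) ≡ χ (false ∷ X)
    determinedBy-head A χ∣A X = χ∣A (true ∷ X) (false ∷ X) λ where (there _) → refl

  probOf-∧-indep : ∀ n p (A B : Subset n) χ ψ → DeterminedBy A χ → DeterminedBy B ψ → Disjoint A B →
    probOf n p (λ X → χ X ∧ ψ X) ≡ probOf n p χ * probOf n p ψ

  private
    -- ψ ignores the first coordinate; the remaining case follows by swapping χ and ψ
    probOf-∧-indep-suc : ∀ n p a (A B : Subset n) χ ψ → DeterminedBy (a ∷ A) χ → DeterminedBy (false ∷ B) ψ →
      Disjoint A B → probOf (suc n) p (λ X → χ X ∧ ψ X) ≡ probOf (suc n) p χ * probOf (suc n) p ψ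
    probOf-∧-indep-suc n p a A B χ ψ χ∣A ψ∣B A#B = begin
      probOf (suc n) p (λ X → χ X ∧ ψ X)
        ≡⟨ probOf-suc n p (λ X → χ X ∧ ψ X) ⟩
      mix p (probOf n p (λ X → χ₁ X ∧ ψ₁ X)) (probOf n p (λ X → χ₀ X ∧ ψ₀ X))
        ≡⟨ cong₂ (mix p) (indep true) (indep false) ⟩
      mix p (probOf n p χ₁ * probOf n p ψ₁) (probOf n p χ₀ * probOf n p ψ₀)
        ≡⟨ cong (λ t → mix p (probOf n p χ₁ * t) (probOf n p χ₀ * probOf n p ψ₀)) ψ₁≡ψ₀ ⟩
      mix p (probOf n p χ₁ * probOf n p ψ₀) (probOf n p χ₀ * probOf n p ψ₀)
        ≡⟨ mix-*ʳ p _ _ _ ⟩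
      mix p (probOf n p χ₁) (probOf n p χ₀) * probOf n p ψ₀
        ≡⟨ cong₂ _*_ (probOf-suc n p χ) ψ≡ψ₀ ⟨
      probOf (suc n) p χ * probOf (suc n) p ψ ∎
      where
      open ≡-Reasoning
      χ₁ = χ ∘ (true ∷_)
      χ₀ = χ ∘ (false ∷_)
      ψ₁ = ψ ∘ (true ∷_)
      ψ₀ = ψ ∘ (false ∷_)
      indep : ∀ x → probOf n p (λ X → χ (x ∷ X) ∧ ψ (x ∷ X))
                  ≡ probOf n p (χ ∘ (x ∷_)) * probOf n p (ψ ∘ (x ∷_))
      indep x = probOf-∧-indep n p A B _ _ (determinedBy-tail a A x χ∣A) (determinedBy-tail false B x ψ∣B) A#B
      ψ₁≡ψ₀ : probOf n p ψ₁ ≡ probOf n p ψ₀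
      ψ₁≡ψ₀ = probOf-cong n p (determinedBy-head B ψ∣B)
      ψ≡ψ₀ : probOf (suc n) p ψ ≡ probOf n p ψ₀
      ψ≡ψ₀ = trans (probOf-suc n p ψ) (trans (cong (λ t → mix p t (probOf n p ψ₀)) ψ₁≡ψ₀) (mix-same p _))

  probOf-∧-indep zero p [] [] χ ψ _ _ _ = begin
    probOf 0 p (λ X → χ X ∧ ψ X)   ≡⟨ probOf-zero p (λ X → χ X ∧ ψ X) ⟩
    𝟙 (χ [] ∧ ψ [])                ≡⟨ 𝟙-∧ (χ []) (ψ []) ⟩
    𝟙 (χ []) * 𝟙 (ψ [])            ≡⟨ cong₂ _*_ (probOf-zero p χ) (probOf-zero p ψ) ⟨
    probOf 0 p χ * probOf 0 p ψ    ∎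
    where
    open ≡-Reasoning
    𝟙-∧ : ∀ b c → 𝟙 (b ∧ c) ≡ 𝟙 b * 𝟙 c
    𝟙-∧ true  true  = refl
    𝟙-∧ true  false = refl
    𝟙-∧ false true  = refl
    𝟙-∧ false false = refl
  probOf-∧-indep (suc n) p (true ∷ A) (true ∷ B) χ ψ _ _ A#B = ⊥-elim (A#B here here)
  probOf-∧-indep (suc n) p (a ∷ A) (false ∷ B) χ ψ χ∣A ψ∣B A#B =
    probOf-∧-indep-suc n p a A B χ ψ χ∣A ψ∣B (disjoint-tail A#B)
  probOf-∧-indep (suc n) p (false ∷ A) (true ∷ B) χ ψ χ∣A ψ∣B A#B = begin
    probOf (suc n) p (λ X → χ X ∧ ψ X)   ≡⟨ probOf-cong (suc n) p (λ X → ∧-comm (χ X) (ψ X)) ⟩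
    probOf (suc n) p (λ X → ψ X ∧ χ X)   ≡⟨ probOf-∧-indep-suc n p true B A ψ χ ψ∣B χ∣A B#A ⟩
    probOf (suc n) p ψ * probOf (suc n) p χ ≡⟨ *-comm (probOf (suc n) p ψ) _ ⟩
    probOf (suc n) p χ * probOf (suc n) p ψ ∎
    where
    open ≡-Reasoning
    B#A : Disjoint B A
    B#A i∈B i∈A = A#B (there i∈A) (there i∈B)

  contains : ∀ {n} → Subset n → Event n
  contains T X = does (T ⊆? X)

  contains⇒⊆ : ∀ {n} {T X : Subset n} → contains T X ≡ true → T ⊆ X
  contains⇒⊆ {T = T} {X} eq with T ⊆? X
  ... | yes T⊆X = T⊆X

  contains-determinedBy : ∀ {n} (T : Subset n) → DeterminedBy T (contains T)
  contains-determinedBy []          []      []      _   = refl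
  contains-determinedBy (true ∷ T)  (true ∷ X)  (true ∷ Y)  X≈Y = contains-determinedBy T X Y (X≈Y ∘ there)
  contains-determinedBy (true ∷ T)  (false ∷ X) (false ∷ Y) X≈Y = refl
  contains-determinedBy (true ∷ T)  (true ∷ X)  (false ∷ Y) X≈Y with () ← X≈Y here
  contains-determinedBy (true ∷ T)  (false ∷ X) (true ∷ Y)  X≈Y with () ← X≈Y here
  contains-determinedBy (false ∷ T) (x ∷ X) (y ∷ Y) X≈Y = contains-determinedBy T X Y (X≈Y ∘ there)

  probOf-contains : ∀ n p (T : Subset n) → probOf n p (contains T) ≡ p ^ℚ ∣ T ∣
  probOf-contains zero    p []          = refl
  probOf-contains (suc n) p (true ∷ T)  = begin
    probOf (suc n) p (contains (true ∷ T))
      ≡⟨ probOf-suc n p (contains (true ∷ T)) ⟩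
    mix p (probOf n p (contains T)) (probOf n p (λ _ → false))
      ≡⟨ cong₂ (mix p) (probOf-contains n p T) (probOf-false n p) ⟩
    mix p (p ^ℚ ∣ T ∣) 0ℚ
      ≡⟨ solve 2 (λ p a → p :* a :+ (con 1ℚ :- p) :* con 0ℚ := p :* a) refl p _ ⟩
    p ^ℚ ∣ true ∷ T ∣ ∎
    where open ≡-Reasoning
  probOf-contains (suc n) p (false ∷ T) =
    trans (probOf-suc n p (contains (false ∷ T))) (trans (mix-same p _) (probOf-contains n p T))

  containsNone : ∀ {n} → List (Subset n) → Event n
  containsNone []       X = true
  containsNone (T ∷ Ts) X = not (contains T X) ∧ containsNone Ts X

  containsNone-determinedBy : ∀ {n} (Ts : List (Subset n)) → DeterminedBy (⋃ Ts) (containsNone Ts)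
  containsNone-determinedBy []       X Y _   = refl
  containsNone-determinedBy (T ∷ Ts) X Y X≈Y =
    cong₂ (λ b c → not b ∧ c) (contains-determinedBy T X Y (X≈Y ∘ p⊆p∪q (⋃ Ts)))
                              (containsNone-determinedBy Ts X Y (X≈Y ∘ q⊆p∪q T (⋃ Ts)))

  probOf-containsNone : ∀ n p s (Ts : List (Subset n)) → 0ℚ ≤ p → p ≤ 1ℚ →
    All (λ T → ∣ T ∣ ℕ.≤ s) Ts → AllPairs Disjoint Ts →
    probOf n p (containsNone Ts) ≤ (1ℚ - p ^ℚ s) ^ℚ length Ts
  probOf-containsNone n p s []       _   _   _ _ = ≤-reflexive (probOf-true n p)
  probOf-containsNone n p s (T ∷ Ts) 0≤p p≤1 (∣T∣≤s ∷ ∣Ts∣≤s) (T#Ts ∷ Ts#) = begin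
    probOf n p (containsNone (T ∷ Ts))
      ≡⟨ probOf-∧-indep n p T (⋃ Ts) (not ∘ contains T) (containsNone Ts)
           (λ X Y X≈Y → cong not (contains-determinedBy T X Y X≈Y)) (containsNone-determinedBy Ts) (disjoint-⋃ Ts T#Ts) ⟩
    probOf n p (not ∘ contains T) * probOf n p (containsNone Ts)
      ≡⟨ cong (_* probOf n p (containsNone Ts)) T⊈X ⟩
    (1ℚ - p ^ℚ ∣ T ∣) * probOf n p (containsNone Ts)
      ≤⟨ *-mono-≤ (p≤1⇒0≤1-p (^-≤1 ∣ T ∣ 0≤p p≤1)) (^-nonNeg (length Ts) (p≤1⇒0≤1-p (^-≤1 s 0≤p p≤1)))
                  (-‿antimonoʳ-≤ 1ℚ (^-antimonoʳ-≤ 0≤p p≤1 ∣T∣≤s))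
                  (probOf-containsNone n p s Ts 0≤p p≤1 ∣Ts∣≤s Ts#) ⟩
    (1ℚ - p ^ℚ s) ^ℚ length (T ∷ Ts) ∎
    where
    open ≤-Reasoning
    T⊈X : probOf n p (not ∘ contains T) ≡ 1ℚ - p ^ℚ ∣ T ∣
    T⊈X = trans (probOf-not′ n p (contains T)) (cong (1ℚ -_) (probOf-contains n p T))

  containsNone≡false : ∀ {n} (Ts : List (Subset n)) X →
    containsNone Ts X ≡ false → ∃ λ T → T ∈ₗ Ts × contains T X ≡ true
  containsNone≡false (T ∷ Ts) X eq with contains T X in T⊆X
  ... | true  = T , here refl , T⊆X
  ... | false with containsNone≡false Ts X eq
  ...   | T′ , T′∈Ts , T′⊆X = T′ , there T′∈Ts , T′⊆X

  someOf : ∀ {n} → List (Event n) → Event n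
  someOf []       X = false
  someOf (e ∷ es) X = e X ∨ someOf es X

  someOf-false : ∀ {n} {e} (es : List (Event n)) X → someOf es X ≡ false → e ∈ₗ es → e X ≡ false
  someOf-false (e ∷ es) X eq (here refl) with e X
  ... | false = refl
  someOf-false (e ∷ es) X eq (there e∈es) with e X
  ... | false = someOf-false es X eq e∈es

  probOf-someOf : ∀ n p β (es : List (Event n)) → 0ℚ ≤ p → p ≤ 1ℚ →
    All (λ e → probOf n p e ≤ β) es → probOf n p (someOf es) ≤ fromℕ (length es) * β
  probOf-someOf n p β []       _   _   []       = ≤-reflexive (trans (probOf-false n p) (sym (*-zeroˡ β)))
  probOf-someOf n p β (e ∷ es) 0≤p p≤1 (e≤β ∷ es≤β) = begin
    probOf n p (someOf (e ∷ es))                   ≤⟨ probOf-∨ n p e (someOf es) 0≤p p≤1 ⟩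
    probOf n p e + probOf n p (someOf es)          ≤⟨ +-mono-≤ e≤β (probOf-someOf n p β es 0≤p p≤1 es≤β) ⟩
    β + fromℕ (length es) * β                      ≡⟨ cong (_+ fromℕ (length es) * β) (*-identityˡ β) ⟨
    1ℚ * β + fromℕ (length es) * β                 ≡⟨ *-distribʳ-+ β 1ℚ (fromℕ (length es)) ⟨
    (1ℚ + fromℕ (length es)) * β                   ≡⟨ cong (_* β) (fromℕ-+ 1 (length es)) ⟨
    fromℕ (length (e ∷ es)) * β                    ∎
    where open ≤-Reasoning

module Configurations {n : ℕ} (G : FinAbGroup n) (b : Fin n) (S : List (Fin n)) where

  open import Data.List
    using ([]; _∷_; map; _++_; length; allFin; take; drop; concatMap; cartesianProduct; cartesianProductWith)
  open import Data.Nat.Solver using (module +-*-Solver)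
  open import Level using (0ℓ)
  open import Algebra.Bundles using (Group)
  import Algebra.Structures as Structures
  import Algebra.Properties.Group as GroupProperties
  open import Data.Fin.Subset using (Subset; ∣_∣)
  open import Data.List.Properties using (length-++; length-map; length-tabulate)
  open import Data.List.Relation.Unary.All as All using (All; []; _∷_)
  import Data.List.Relation.Unary.All.Properties as All
  open import Data.List.Relation.Unary.AllPairs using (AllPairs; []; _∷_)
  import Data.List.Relation.Unary.AllPairs.Properties as AllPairs
  open import Function using (_on_; _∘_)
  open import Data.List.Membership.Propositional using (_∈_; _∉_)
  open import Data.List.Membership.Propositional.Properties
    using ( ∈-map⁺; ∈-map⁻; ∈-++⁺ˡ; ∈-++⁺ʳ; ∈-++⁻; ∈-allFin; ∈-concatMap⁺
          ; ∈-cartesianProductWith⁺; ∈-cartesianProduct⁺)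
  open import Data.List.Relation.Unary.Any as Any using (here; there)
  open import Data.Product using (∃; _×_; _,_)
  open import Data.Sum using (_⊎_; inj₁; inj₂)
  open import Data.Empty using (⊥)
  open Lists
  open Subsets
  open FinAbGroup G
  open Structures.IsAbelianGroup isAbelianGroup using (isGroup; comm)

  group : Group 0ℓ 0ℓ
  group = record { isGroup = isGroup }

  open Group group using (_//_; _\\_)
  open GroupProperties group using (x≈z//y; \\-leftDividesˡ; //-rightDividesʳ)

  Pair : Set
  Pair = Fin n × Fin n

  third : Pair → Fin n
  third (x , y) = (x ⊕ y) \\ b

  third-sum : ∀ x y → (x ⊕ y) ⊕ third (x , y) ≡ b
  third-sum x y = \\-leftDividesˡ (x ⊕ y) b

  partner : Fin n → Fin n → Fin n
  partner z t = (b // z) // t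

  private
    x⊕y≡b//z : ∀ {x y z} → third (x , y) ≡ z → x ⊕ y ≡ b // z
    x⊕y≡b//z {x} {y} refl = x≈z//y (x ⊕ y) _ b (third-sum x y)

  third≡⇒snd≡ : ∀ {x y z} → third (x , y) ≡ z → y ≡ partner z x
  third≡⇒snd≡ {x} {y} eq = x≈z//y y x _ (trans (comm y x) (x⊕y≡b//z eq))

  third≡⇒fst≡ : ∀ {x y z} → third (x , y) ≡ z → x ≡ partner z y
  third≡⇒fst≡ {x} {y} eq = x≈z//y x y _ (x⊕y≡b//z eq)

  translates : Pair → List (Fin n)
  translates (x , y) = map (x ⊕_) S ++ map (y ⊕_) S ++ map (third (x , y) ⊕_) S

  cell : Pair → Subset n
  cell pr = toSubset (translates pr)

  Apart : Fin n → Fin n → Set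
  Apart u v = ∀ {a a′} → a ∈ S → a′ ∈ S → u ⊕ a ≢ v ⊕ a′

  Separated : Pair → Set
  Separated (x , y) = Apart x y × Apart x (third (x , y)) × Apart y (third (x , y))

  Avoids : List (Fin n) → Pair → Set
  Avoids W pr = ∀ {i} → i ∈ translates pr → i ∉ W

  private
    sweep : List (Fin n × Fin n) → (Fin n × Fin n → Fin n → Pair) → List Pair
    sweep us f = cartesianProductWith f us (allFin n)

  -- (x , y) is bad when x, y or z lies in W − S, or two of x + S, y + S, z + S meet;
  -- each family lists the pairs meeting one such condition, t being the free coordinate
  badPairs : List (Fin n) → List Pair
  badPairs W = concatMap (sweep WS) hits ++ concatMap (sweep SS) meets
    module BadPairs where
    WS = cartesianProduct W S
    SS = cartesianProduct S S
    hitX hitY hitZ meetXY meetXZ meetYZ : Fin n × Fin n → Fin n → Pair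
    hitX   (w , a)  t = w // a , t
    hitY   (w , a)  t = t , w // a
    hitZ   (w , a)  t = t , partner (w // a) t
    meetXY (a , a′) t = t , (t ⊕ a) // a′
    meetXZ (a , a′) t = t , partner ((t ⊕ a) // a′) t
    meetYZ (a , a′) t = partner ((t ⊕ a) // a′) t , t
    hits meets : List (Fin n × Fin n → Fin n → Pair)
    hits  = hitX ∷ hitY ∷ hitZ ∷ []
    meets = meetXY ∷ meetXZ ∷ meetYZ ∷ []

  module _ {x y : Fin n} {a : Fin n} (a∈S : a ∈ S) where
    ∈-translates-fst : x ⊕ a ∈ translates (x , y)
    ∈-translates-fst = ∈-++⁺ˡ (∈-map⁺ (x ⊕_) a∈S)

    ∈-translates-snd : y ⊕ a ∈ translates (x , y)
    ∈-translates-snd = ∈-++⁺ʳ (map (x ⊕_) S) (∈-++⁺ˡ (∈-map⁺ (y ⊕_) a∈S))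

    ∈-translates-third : third (x , y) ⊕ a ∈ translates (x , y)
    ∈-translates-third =
      ∈-++⁺ʳ (map (x ⊕_) S) (∈-++⁺ʳ (map (y ⊕_) S) (∈-map⁺ (third (x , y) ⊕_) a∈S))

  ∈-translates⁻ : ∀ {i} x y → i ∈ translates (x , y) →
    ∃ λ a → a ∈ S × (i ≡ x ⊕ a ⊎ i ≡ y ⊕ a ⊎ i ≡ third (x , y) ⊕ a)
  ∈-translates⁻ x y i∈ with ∈-++⁻ (map (x ⊕_) S) i∈
  ... | inj₁ i∈x+S with ∈-map⁻ (x ⊕_) i∈x+S
  ...   | a , a∈S , i≡ = a , a∈S , inj₁ i≡
  ∈-translates⁻ x y i∈ | inj₂ i∈′ with ∈-++⁻ (map (y ⊕_) S) i∈′
  ... | inj₁ i∈y+S with ∈-map⁻ (y ⊕_) i∈y+S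
  ...   | a , a∈S , i≡ = a , a∈S , inj₂ (inj₁ i≡)
  ∈-translates⁻ x y i∈ | inj₂ i∈′ | inj₂ i∈z+S with ∈-map⁻ (third (x , y) ⊕_) i∈z+S
  ...   | a , a∈S , i≡ = a , a∈S , inj₂ (inj₂ i≡)

  separated-avoiding : ∀ W x y → (x , y) ∉ badPairs W → Separated (x , y) × Avoids W (x , y)
  separated-avoiding W x y ∉bad = (apartXY , apartXZ , apartYZ) , avoids
    where
    open BadPairs W
    z = third (x , y)

    hit : ∀ {f} → f ∈ hits → (x , y) ∈ sweep WS f → ⊥
    hit f∈ bad = ∉bad (∈-++⁺ˡ (∈-concatMap⁺ (sweep WS) (Any.map (λ { refl → bad }) f∈)))

    meet : ∀ {f} → f ∈ meets → (x , y) ∈ sweep SS f → ⊥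
    meet f∈ bad =
      ∉bad (∈-++⁺ʳ (concatMap (sweep WS) hits) (∈-concatMap⁺ (sweep SS) (Any.map (λ { refl → bad }) f∈)))

    swept : ∀ {us} f {u} t → u ∈ us → f u t ≡ (x , y) → (x , y) ∈ sweep us f
    swept {us} f t u∈us eq = subst (_∈ sweep us f) eq (∈-cartesianProductWith⁺ f u∈us (∈-allFin t))

    i//a≡ : ∀ {i a} u → i ≡ u ⊕ a → i // a ≡ u
    i//a≡ {a = a} u refl = //-rightDividesʳ a u

    apartXY : Apart x y
    apartXY {a} {a′} a∈S a′∈S eq = meet (here refl) bad
      where
      y≡ = x≈z//y y a′ (x ⊕ a) (sym eq)
      bad = swept meetXY x (∈-cartesianProduct⁺ a∈S a′∈S) (cong (x ,_) (sym y≡))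

    apartXZ : Apart x z
    apartXZ {a} {a′} a∈S a′∈S eq = meet (there (here refl)) bad
      where
      z≡ = x≈z//y z a′ (x ⊕ a) (sym eq)
      bad = swept meetXZ x (∈-cartesianProduct⁺ a∈S a′∈S) (cong (x ,_) (sym (third≡⇒snd≡ z≡)))

    apartYZ : Apart y z
    apartYZ {a} {a′} a∈S a′∈S eq = meet (there (there (here refl))) bad
      where
      z≡ = x≈z//y z a′ (y ⊕ a) (sym eq)
      bad = swept meetYZ y (∈-cartesianProduct⁺ a∈S a′∈S) (cong (_, y) (sym (third≡⇒fst≡ z≡)))

    avoids : Avoids W (x , y)
    avoids {i} i∈ i∈W with ∈-translates⁻ x y i∈
    ... | a , a∈S , inj₁ i≡ =
      hit (here refl) (swept hitX y (∈-cartesianProduct⁺ i∈W a∈S) (cong (_, y) (i//a≡ x i≡)))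
    ... | a , a∈S , inj₂ (inj₁ i≡) =
      hit (there (here refl)) (swept hitY x (∈-cartesianProduct⁺ i∈W a∈S) (cong (x ,_) (i//a≡ y i≡)))
    ... | a , a∈S , inj₂ (inj₂ i≡) =
      hit (there (there (here refl))) (swept hitZ x (∈-cartesianProduct⁺ i∈W a∈S) (cong (x ,_) y≡))
      where y≡ = sym (third≡⇒snd≡ (sym (i//a≡ z i≡)))

  cellSize : ℕ
  cellSize = length S ℕ.+ (length S ℕ.+ length S)

  length-translates : ∀ pr → length (translates pr) ≡ cellSize
  length-translates (x , y) = trans (length-++ (map (x ⊕_) S)) (cong₂ ℕ._+_ (length-map (x ⊕_) S)
    (trans (length-++ (map (y ⊕_) S)) (cong₂ ℕ._+_ (length-map (y ⊕_) S) (length-map (third (x , y) ⊕_) S))))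

  ∣cell∣≤cellSize : ∀ pr → ∣ cell pr ∣ ℕ.≤ cellSize
  ∣cell∣≤cellSize pr = ℕ.≤-trans (∣toSubset∣≤length (translates pr)) (ℕ.≤-reflexive (length-translates pr))

  length-badPairs : ∀ W →
    length (badPairs W) ≡ 3 ℕ.* (length W ℕ.* length S ℕ.* n) ℕ.+ 3 ℕ.* (length S ℕ.* length S ℕ.* n)
  length-badPairs W = trans (length-++ (concatMap (sweep WS) hits))
    (cong₂ ℕ._+_ (length-concatMap (sweep WS) _ hits (lengthOver W))
                 (length-concatMap (sweep SS) _ meets (lengthOver S)))
    where
    open BadPairs W
    lengthOver : ∀ V f → length (sweep (cartesianProduct V S) f) ≡ length V ℕ.* length S ℕ.* n
    lengthOver V f = trans (length-cartesianProductWith f (cartesianProduct V S) (allFin n))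
      (cong₂ ℕ._*_ (length-cartesianProductWith _,_ V S) (length-tabulate {n = n} (λ i → i)))

  badPairs-short : ∀ j W → 1 ℕ.≤ length S → 1 ℕ.≤ n → length W ≡ j ℕ.* cellSize →
    suc j ℕ.* (cellSize ℕ.* cellSize) ℕ.≤ n → length (badPairs W) ℕ.< n ℕ.* n
  badPairs-short j W 1≤σ 1≤n len≡ room = begin-strict
    length (badPairs W)                      ≡⟨ length≡E ⟩
    E                                        <⟨ ℕ.m<m+n E 0<6s ⟩
    E ℕ.+ 6 ℕ.* s                            ≡⟨ E+6s≡ ⟩
    suc j ℕ.* (cellSize ℕ.* cellSize) ℕ.* n  ≤⟨ ℕ.*-monoˡ-≤ n room ⟩
    n ℕ.* n                                  ∎
    where
    open ℕ.≤-Reasoning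
    open +-*-Solver
    σ = length S
    s = σ ℕ.* σ ℕ.* n
    E = 3 ℕ.* (j ℕ.* cellSize ℕ.* σ ℕ.* n) ℕ.+ 3 ℕ.* s
    length≡E : length (badPairs W) ≡ E
    length≡E = trans (length-badPairs W) (cong (λ l → 3 ℕ.* (l ℕ.* σ ℕ.* n) ℕ.+ 3 ℕ.* s) len≡)
    E+6s≡ : E ℕ.+ 6 ℕ.* s ≡ suc j ℕ.* (cellSize ℕ.* cellSize) ℕ.* n
    E+6s≡ = solve 3 (λ j σ n → let c = σ :+ (σ :+ σ) in
                                con 3 :* (j :* c :* σ :* n) :+ con 3 :* (σ :* σ :* n) :+ con 6 :* (σ :* σ :* n)
                                := (con 1 :+ j) :* (c :* c) :* n)
                    refl j σ n
    0<6s : 0 ℕ.< 6 ℕ.* s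
    0<6s = ℕ.*-mono-≤ {1} {6} (ℕ.s≤s ℕ.z≤n) (ℕ.*-mono-≤ (ℕ.*-mono-≤ 1≤σ 1≤σ) 1≤n)

  record Configuration (ps : List Pair) : Set where
    field
      separated : All Separated ps
      disjoint  : AllPairs (Disjoint on cell) ps

  configuration-take : ∀ k {ps} → Configuration ps → Configuration (take k ps)
  configuration-take k c = record
    { separated = All.take⁺ k (Configuration.separated c)
    ; disjoint  = AllPairs.take⁺ k (Configuration.disjoint c)
    }

  configuration-drop : ∀ k {ps} → Configuration ps → Configuration (drop k ps)
  configuration-drop k c = record
    { separated = All.drop⁺ k (Configuration.separated c)
    ; disjoint  = AllPairs.drop⁺ k (Configuration.disjoint c)
    }

  footprint : List Pair → List (Fin n)
  footprint []        = []
  footprint (pr ∷ ps) = translates pr ++ footprint ps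

  length-footprint : ∀ ps → length (footprint ps) ≡ length ps ℕ.* cellSize
  length-footprint []        = refl
  length-footprint (pr ∷ ps) =
    trans (length-++ (translates pr)) (cong₂ ℕ._+_ (length-translates pr) (length-footprint ps))

  avoids⇒disjoint : ∀ pr ps → Avoids (footprint ps) pr → All (Disjoint (cell pr) ∘ cell) ps
  avoids⇒disjoint pr []       _  = []
  avoids⇒disjoint pr (q ∷ qs) av =
    (λ i∈pr i∈q → av (∈-toSubset⁻ (translates pr) i∈pr) (∈-++⁺ˡ (∈-toSubset⁻ (translates q) i∈q)))
    ∷ avoids⇒disjoint pr qs (λ i∈pr i∈qs → av i∈pr (∈-++⁺ʳ (translates q) i∈qs))

  greedy : ∀ k → 1 ℕ.≤ length S → 1 ℕ.≤ n → k ℕ.* (cellSize ℕ.* cellSize) ℕ.≤ n →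
    ∃ λ ps → length ps ≡ k × Configuration ps
  greedy zero    _   _   _    = [] , refl , record { separated = [] ; disjoint = [] }
  greedy (suc k) 1≤σ 1≤n room =
    let ps , length≡k , c = greedy k 1≤σ 1≤n (ℕ.≤-trans (ℕ.m≤n+m _ _) room)
        length≡ = trans (length-footprint ps) (cong (ℕ._* cellSize) length≡k)
        few = badPairs-short k (footprint ps) 1≤σ 1≤n length≡ room
        (x , y) , ∉bad = missingPair (badPairs (footprint ps)) few
        sep , avoids = separated-avoiding (footprint ps) x y ∉bad
    in (x , y) ∷ ps , cong suc length≡k , record
      { separated = sep ∷ Configuration.separated c
      ; disjoint  = avoids⇒disjoint (x , y) ps avoids ∷ Configuration.disjoint c
      }

module NatFacts where

  open import Data.Nat using (_*_; _^_; _≤_; _<_; z≤n; s≤s)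
  open import Relation.Nullary using (yes; no)
  open import Data.Empty using (⊥-elim)
  open import Algebra.Properties.CommutativeSemigroup ℕ.*-commutativeSemigroup using (interchange)

  1≤m^n : ∀ {m} n → 1 ≤ m → 1 ≤ m ^ n
  1≤m^n zero    _   = s≤s z≤n
  1≤m^n (suc n) 1≤m = ℕ.*-mono-≤ 1≤m (1≤m^n n 1≤m)

  m≤m^n : ∀ {m n} → 1 ≤ m → 1 ≤ n → m ≤ m ^ n
  m≤m^n {m} {suc n} 1≤m _ =
    ℕ.≤-trans (ℕ.≤-reflexive (sym (ℕ.*-identityʳ m))) (ℕ.*-monoʳ-≤ m (1≤m^n n 1≤m))

  n<2^n : ∀ n → n < 2 ^ n
  n<2^n zero    = s≤s z≤n
  n<2^n (suc n) =
    ℕ.+-mono-≤-< (1≤m^n n (s≤s z≤n)) (ℕ.<-≤-trans (n<2^n n) (ℕ.≤-reflexive (sym (ℕ.+-identityʳ _))))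

  ^-distribʳ-* : ∀ a b k → (a * b) ^ k ≡ a ^ k * b ^ k
  ^-distribʳ-* a b zero    = refl
  ^-distribʳ-* a b (suc k) = trans (cong ((a * b) *_) (^-distribʳ-* a b k)) (interchange a b (a ^ k) (b ^ k))

  ^-cancelʳ-≤ : ∀ {a b} k → a ^ suc k ≤ b ^ suc k → a ≤ b
  ^-cancelʳ-≤ {a} {b} k a^k≤b^k with a ℕ.≤? b
  ... | yes a≤b = a≤b
  ... | no  a≰b = ⊥-elim (ℕ.<-irrefl refl (ℕ.≤-<-trans a^k≤b^k (ℕ.^-monoˡ-< (suc k) (ℕ.≰⇒> a≰b))))

module IntegerRoot (R : ℕ) (1≤R : 1 ℕ.≤ R) where

  open import Data.Nat using (_^_; _≤_; _<_; z≤n; s≤s)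
  open import Relation.Nullary using (yes; no)
  open import Data.Empty using (⊥-elim)
  open import Data.Sum using (inj₁; inj₂)
  open NatFacts using (m≤m^n)

  private
    search : ℕ → ℕ → ℕ
    search n zero    = 1
    search n (suc t) with suc t ^ R ℕ.≤? n
    ... | yes _ = suc t
    ... | no  _ = search n t

    1≤search : ∀ n t → 1 ≤ search n t
    1≤search n zero    = s≤s z≤n
    1≤search n (suc t) with suc t ^ R ℕ.≤? n
    ... | yes _ = s≤s z≤n
    ... | no  _ = 1≤search n t

    search^R≤n : ∀ n t → 1 ≤ n → search n t ^ R ≤ n
    search^R≤n n zero    1≤n = ℕ.≤-trans (ℕ.≤-reflexive (ℕ.^-zeroˡ R)) 1≤n
    search^R≤n n (suc t) 1≤n with suc t ^ R ℕ.≤? n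
    ... | yes ok = ok
    ... | no  _  = search^R≤n n t 1≤n

    search-max : ∀ n t {u} → u ≤ t → u ^ R ≤ n → u ≤ search n t
    search-max n zero    z≤n _ = z≤n
    search-max n (suc t) u≤t u^R≤n with suc t ^ R ℕ.≤? n
    ... | yes _ = u≤t
    ... | no  ¬ok with ℕ.m≤n⇒m<n∨m≡n u≤t
    ...   | inj₁ u<t  = search-max n t (ℕ.≤-pred u<t) u^R≤n
    ...   | inj₂ refl = ⊥-elim (¬ok u^R≤n)

  root : ℕ → ℕ
  root n = search n n

  1≤root : ∀ n → 1 ≤ root n
  1≤root n = 1≤search n n

  root^R≤n : ∀ n → 1 ≤ n → root n ^ R ≤ n
  root^R≤n n = search^R≤n n n

  root-max : ∀ n {u} → u ^ R ≤ n → u ≤ root n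
  root-max n {zero}  _     = z≤n
  root-max n {suc u} u^R≤n = search-max n n (ℕ.≤-trans (m≤m^n (s≤s z≤n) 1≤R) u^R≤n) u^R≤n

  n<[1+root]^R : ∀ n → n < suc (root n) ^ R
  n<[1+root]^R n with suc (root n) ^ R ℕ.≤? n
  ... | yes ok = ⊥-elim (ℕ.<-irrefl refl (root-max n ok))
  ... | no  ¬ok = ℕ.≰⇒> ¬ok

-- Offsets 0, a₁ … a_Δ give cells of at most s elements. With T = ⌊n^(1/R)⌋ and W = T + 1:
-- K = n / T^e bounds ∣U∣ ≤ n^(1−μ) because R = D e and D is the denominator of μ;
-- a block of L = W^s (cW + T) disjoint cells misses X with probability at most 2^(−(cW + T));
-- c = R (σ + 1) makes 2^(cW) ≥ n^(Δ+2) exceed the number of blocks over all b and N;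
-- e = s + 2 leaves room for the greedy choice of all (K + 1) L pairs once T ≥ threshold.
module Parameters (Δ D0 : ℕ) where

  open import Data.Nat using (_+_; _*_; _^_; _≤_; z≤n; s≤s; NonZero)
  open import Data.Nat.DivMod using (_/_; m*n/n≡m; /-monoˡ-≤; m/n*n≤m; m/n≤m; m≥n⇒m/n>0)
  open import Data.Nat.Solver using (module +-*-Solver)
  open +-*-Solver
  open NatFacts

  σ s e D R c : ℕ
  σ = suc Δ
  s = σ + (σ + σ)
  e = suc (suc s)
  D = suc D0
  R = D * e
  c = R * suc σ

  open IntegerRoot R (s≤s z≤n) public

  W : ℕ → ℕ
  W n = suc (root n)

  private
    T^e≢0 : ∀ n → NonZero (root n ^ e)
    T^e≢0 n = ℕ.>-nonZero (1≤m^n e (1≤root n))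

  K : ℕ → ℕ
  K n = (n / root n ^ e) {{T^e≢0 n}}

  L : ℕ → ℕ
  L n = W n ^ s * (c * W n + root n)

  blocks : ℕ → ℕ
  blocks n = suc (K n)

  totalPairs : ℕ → ℕ
  totalPairs n = blocks n * L n

  threshold : ℕ
  threshold = 2 * (2 ^ s * ((c + c + 1) * (s * s)))

  u≤K : ∀ n u → 1 ≤ n → u ^ D * n ≤ n ^ D → u ≤ K n
  u≤K n u 1≤n u^D*n≤n^D = ℕ.≤-trans (ℕ.≤-reflexive (sym (m*n/n≡m u (root n ^ e) {{T^e≢0 n}})))
                                     (/-monoˡ-≤ (root n ^ e) {{T^e≢0 n}} u*T^e≤n)
    where
    open ℕ.≤-Reasoning
    u*T^e≤n : u * root n ^ e ≤ n
    u*T^e≤n = ^-cancelʳ-≤ D0 (begin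
      (u * root n ^ e) ^ D       ≡⟨ ^-distribʳ-* u (root n ^ e) D ⟩
      u ^ D * (root n ^ e) ^ D   ≡⟨ cong (u ^ D *_) (trans (ℕ.^-*-assoc (root n) e D) (cong (root n ^_) (ℕ.*-comm e D))) ⟩
      u ^ D * root n ^ R         ≤⟨ ℕ.*-monoʳ-≤ (u ^ D) (root^R≤n n 1≤n) ⟩
      u ^ D * n                  ≤⟨ u^D*n≤n^D ⟩
      n ^ D                      ∎)

  #events≤ : ∀ n → n * n ^ Δ * blocks n ≤ 2 ^ (c * W n)
  #events≤ n = begin
    n * n ^ Δ * blocks n     ≤⟨ ℕ.*-mono-≤ (ℕ.*-mono-≤ (ℕ.n≤1+n n) (ℕ.^-monoˡ-≤ Δ (ℕ.n≤1+n n))) (s≤s K≤n) ⟩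
    suc n ^ σ * suc n        ≡⟨ ℕ.*-comm (suc n ^ σ) (suc n) ⟩
    suc n ^ suc σ            ≤⟨ ℕ.^-monoˡ-≤ (suc σ) (n<[1+root]^R n) ⟩
    (W n ^ R) ^ suc σ        ≡⟨ ℕ.^-*-assoc (W n) R (suc σ) ⟩
    W n ^ c                  ≤⟨ ℕ.^-monoˡ-≤ c (ℕ.<⇒≤ (n<2^n (W n))) ⟩
    (2 ^ W n) ^ c            ≡⟨ ℕ.^-*-assoc 2 (W n) c ⟩
    2 ^ (W n * c)            ≡⟨ cong (2 ^_) (ℕ.*-comm (W n) c) ⟩
    2 ^ (c * W n)            ∎
    where
    open ℕ.≤-Reasoning
    K≤n = m/n≤m n (root n ^ e) {{T^e≢0 n}}

  private
    1≤K : ∀ n → 1 ≤ n → 1 ≤ K n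
    1≤K n 1≤n = m≥n⇒m/n>0 {{T^e≢0 n}}
      (ℕ.≤-trans (ℕ.^-monoʳ-≤ (root n) {{ℕ.>-nonZero (1≤root n)}} (ℕ.m≤n*m e D)) (root^R≤n n 1≤n))

    2*L*s²≤T^e : ∀ n → threshold ≤ root n → 2 * L n * (s * s) ≤ root n ^ e
    2*L*s²≤T^e n threshold≤t = begin
      2 * (W n ^ s * (c * W n + t)) * (s * s)
        ≤⟨ ℕ.*-monoˡ-≤ (s * s) (ℕ.*-monoʳ-≤ 2 L≤) ⟩
      2 * ((2 * t) ^ s * (c * (2 * t) + t)) * (s * s)
        ≡⟨ cong (λ x → 2 * (x * (c * (2 * t) + t)) * (s * s)) (^-distribʳ-* 2 t s) ⟩
      2 * ((2 ^ s * t ^ s) * (c * (2 * t) + t)) * (s * s)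
        ≡⟨ regroup ⟩
      threshold * (t * t ^ s)
        ≤⟨ ℕ.*-monoˡ-≤ (t * t ^ s) threshold≤t ⟩
      t * (t * t ^ s) ∎
      where
      open ℕ.≤-Reasoning
      t = root n
      W≤2t : W n ≤ 2 * t
      W≤2t = ℕ.≤-trans (ℕ.+-monoˡ-≤ t (1≤root n)) (ℕ.≤-reflexive (cong (t +_) (sym (ℕ.+-identityʳ t))))
      L≤ : L n ≤ (2 * t) ^ s * (c * (2 * t) + t)
      L≤ = ℕ.*-mono-≤ (ℕ.^-monoˡ-≤ s W≤2t) (ℕ.+-monoˡ-≤ t (ℕ.*-monoʳ-≤ c W≤2t))
      regroup : 2 * ((2 ^ s * t ^ s) * (c * (2 * t) + t)) * (s * s) ≡ threshold * (t * t ^ s)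
      regroup = solve 5 (λ p q t c k → con 2 :* ((p :* q) :* (c :* (con 2 :* t) :+ t)) :* k
                                    := con 2 :* (p :* ((c :+ c :+ con 1) :* k)) :* (t :* q)) refl (2 ^ s) (t ^ s) t c (s * s)

  room : ∀ n → 1 ≤ n → threshold ≤ root n → totalPairs n * (s * s) ≤ n
  room n 1≤n threshold≤T = begin
    totalPairs n * (s * s)       ≤⟨ ℕ.*-monoˡ-≤ (s * s) (ℕ.*-monoˡ-≤ (L n) 1+K≤K+K) ⟩
    (K n + K n) * L n * (s * s)  ≡⟨ solve 3 (λ k l c → (k :+ k) :* l :* c := k :* (con 2 :* l :* c)) refl (K n) (L n) _ ⟩
    K n * (2 * L n * (s * s))    ≤⟨ ℕ.*-monoʳ-≤ (K n) (2*L*s²≤T^e n threshold≤T) ⟩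
    K n * root n ^ e             ≤⟨ m/n*n≤m n (root n ^ e) {{T^e≢0 n}} ⟩
    n                            ∎
    where
    open ℕ.≤-Reasoning
    1+K≤K+K : suc (K n) ≤ K n + K n
    1+K≤K+K = ℕ.≤-trans (ℕ.≤-reflexive (ℕ.+-comm 1 (K n))) (ℕ.+-monoʳ-≤ (K n) (1≤K n 1≤n))

module Exponents where

  open import Data.Integer as ℤ using (+_; -[1+_])
  import Data.Integer.Properties as ℤ
  open import Data.Rational as ℚ using (0ℚ; 1ℚ; ½; _*_; _≤_; _<_; mkℚ; *≤*; *<*)
  open import Data.Rational.Properties
  open import Algebra.Bundles using (CommutativeMonoid)
  open import Algebra.Properties.CommutativeSemigroup (CommutativeMonoid.commutativeSemigroup *-1-commutativeMonoid)
    using (x∙yz≈y∙xz)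
  import Data.Nat.Coprimality as Coprime
  open import Data.Empty using (⊥-elim)
  open Rationals

  1/[1+_] : ℕ → ℚ
  1/[1+ k ] = mkℚ (+ 1) k (Coprime.1-coprimeTo (suc k))

  0<1/[1+k] : ∀ k → 0ℚ < 1/[1+ k ]
  0<1/[1+k] k = *<* (ℤ.+<+ (ℕ.s≤s ℕ.z≤n))

  1≤num : ∀ {q} → 0ℚ < q → 1 ℕ.≤ num q
  1≤num {mkℚ (+ suc k) _ _}     _   = ℕ.s≤s ℕ.z≤n
  1≤num {q@(mkℚ (+ zero) _ _)}  0<q = ⊥-elim (<-irrefl (sym (↥p≡0⇒p≡0 q refl)) 0<q)
  1≤num {q@(mkℚ -[1+ _ ] _ _)} 0<q = ⊥-elim (<-asym 0<q (negative⁻¹ q))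

  num*[1+k]≤den : ∀ {q} k → 0ℚ < q → q ≤ 1/[1+ k ] → num q ℕ.* suc k ℕ.≤ den q
  num*[1+k]≤den {mkℚ (+ m) d _} k _ (*≤* le) =
    ℤ.drop‿+≤+ (subst₂ ℤ._≤_ (sym (ℤ.pos-* m (suc k))) (ℤ.*-identityˡ (+ suc d)) le)
  num*[1+k]≤den {q@(mkℚ -[1+ _ ] _ _)} k 0<q _ = ⊥-elim (<-asym 0<q (negative⁻¹ q))

  1/[1+den]<q : ∀ {q} → 0ℚ < q → 1/[1+ den q ] < q
  1/[1+den]<q {mkℚ (+ suc a) d _} _ = *<* (subst₂ ℤ._<_ (sym (ℤ.*-identityˡ (+ suc d))) (ℤ.pos-* (suc a) (suc (suc d)))
    (ℤ.+<+ (ℕ.≤-trans (ℕ.n<1+n (suc d)) (ℕ.m≤n*m (suc (suc d)) (suc a)))))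
  1/[1+den]<q {q@(mkℚ (+ zero) _ _)}  0<q = ⊥-elim (<-irrefl (sym (↥p≡0⇒p≡0 q refl)) 0<q)
  1/[1+den]<q {q@(mkℚ -[1+ _ ] _ _)} 0<q = ⊥-elim (<-asym 0<q (negative⁻¹ q))

  ½^t≤1/[1+k] : ∀ t k → suc k ℕ.≤ 2 ℕ.^ t → ½ ^ℚ t ≤ 1/[1+ k ]
  ½^t≤1/[1+k] t k 1+k≤2^t = begin
    ½ ^ℚ t                                  ≡⟨ *-identityʳ (½ ^ℚ t) ⟨
    ½ ^ℚ t * 1ℚ                             ≡⟨ cong (½ ^ℚ t *_) inverse ⟨
    ½ ^ℚ t * (1/[1+ k ] * fromℕ (suc k))     ≡⟨ x∙yz≈y∙xz (½ ^ℚ t) 1/[1+ k ] (fromℕ (suc k)) ⟩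
    1/[1+ k ] * (½ ^ℚ t * fromℕ (suc k))     ≤⟨ *-monoˡ-≤ (<⇒≤ (0<1/[1+k] k)) (*-monoˡ-≤ 0≤½^t (fromℕ-mono-≤ 1+k≤2^t)) ⟩
    1/[1+ k ] * (½ ^ℚ t * fromℕ (2 ℕ.^ t))   ≡⟨ cong (1/[1+ k ] *_) ½^t*2^t≡1 ⟩
    1/[1+ k ] * 1ℚ                           ≡⟨ *-identityʳ 1/[1+ k ] ⟩
    1/[1+ k ]                                ∎
    where
    open ≤-Reasoning
    0≤½^t = ^-nonNeg t (nonNegative⁻¹ ½)
    inverse : 1/[1+ k ] * fromℕ (suc k) ≡ 1ℚ
    inverse = trans (cong (1/[1+ k ] *_) (fromℕ≡mkℚ (suc k)))
                    (*-inverseˡ (mkℚ (+ suc k) 0 (Coprime.sym (Coprime.1-coprimeTo (suc k)))))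
    ½^t*2^t≡1 : ½ ^ℚ t * fromℕ (2 ℕ.^ t) ≡ 1ℚ
    ½^t*2^t≡1 = trans (*-comm (½ ^ℚ t) _)
      (subst (λ u → fromℕ (2 ℕ.^ t) * ½ ^ℚ u ≡ 1ℚ) (ℕ.+-identityʳ t) (2^a*½^[a+t]≡½^t t 0))

  1≤p^R*n : ∀ {n ρ p} R → 0ℚ ≤ p → 1 ℕ.≤ n → num ρ ℕ.* R ℕ.≤ den ρ → NegPowLe n ρ p →
    1ℚ ≤ p ^ℚ R * fromℕ n
  1≤p^R*n {n} {ρ} {p} R 0≤p 1≤n kR≤d 1≤p^d*n^k =
    1≤x^[1+k]⇒1≤x (den ρ ℕ.∸ 1) (*-nonNeg (^-nonNeg R 0≤p) (fromℕ-nonNeg n)) (begin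
      1ℚ
        ≤⟨ 1≤^ R 1≤p^d*n^k ⟩
      (p ^ℚ d * fromℕ (n ℕ.^ k)) ^ℚ R
        ≡⟨ ^-distribʳ-* (p ^ℚ d) (fromℕ (n ℕ.^ k)) R ⟩
      (p ^ℚ d) ^ℚ R * fromℕ (n ℕ.^ k) ^ℚ R
        ≡⟨ cong₂ _*_ (^-*-assoc p d R) (trans (cong (_^ℚ R) (fromℕ-^ n k)) (^-*-assoc (fromℕ n) k R)) ⟩
      p ^ℚ (d ℕ.* R) * fromℕ n ^ℚ (k ℕ.* R)
        ≤⟨ *-monoˡ-≤ (^-nonNeg (d ℕ.* R) 0≤p) (^-monoʳ-≤ (fromℕ-mono-≤ 1≤n) kR≤d) ⟩
      p ^ℚ (d ℕ.* R) * fromℕ n ^ℚ d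
        ≡⟨ cong (_* fromℕ n ^ℚ d) (trans (cong (p ^ℚ_) (ℕ.*-comm d R)) (sym (^-*-assoc p R d))) ⟩
      (p ^ℚ R) ^ℚ d * fromℕ n ^ℚ d
        ≡⟨ ^-distribʳ-* (p ^ℚ R) (fromℕ n) d ⟨
      (p ^ℚ R * fromℕ n) ^ℚ d ∎)
    where
    open ≤-Reasoning
    d = den ρ
    k = num ρ

  1≤p*W : ∀ {p n} R′ W → 0ℚ ≤ p → n ℕ.≤ W ℕ.^ suc R′ → 1ℚ ≤ p ^ℚ suc R′ * fromℕ n →
    1ℚ ≤ p * fromℕ W
  1≤p*W {p} {n} R′ W 0≤p n≤W^R 1≤p^R*n = 1≤x^[1+k]⇒1≤x R′ (*-nonNeg 0≤p (fromℕ-nonNeg W)) (begin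
    1ℚ                                   ≤⟨ 1≤p^R*n ⟩
    p ^ℚ suc R′ * fromℕ n                ≤⟨ *-monoˡ-≤ (^-nonNeg (suc R′) 0≤p) (fromℕ-mono-≤ n≤W^R) ⟩
    p ^ℚ suc R′ * fromℕ (W ℕ.^ suc R′)   ≡⟨ cong (p ^ℚ suc R′ *_) (fromℕ-^ W (suc R′)) ⟩
    p ^ℚ suc R′ * fromℕ W ^ℚ suc R′      ≡⟨ ^-distribʳ-* p (fromℕ W) (suc R′) ⟨
    (p * fromℕ W) ^ℚ suc R′              ∎)
    where open ≤-Reasoning

  1≤p^s*W^s : ∀ {p} W s → 1ℚ ≤ p * fromℕ W → 1ℚ ≤ p ^ℚ s * fromℕ (W ℕ.^ s)
  1≤p^s*W^s {p} W s 1≤pW =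
    ≤-trans (1≤^ s 1≤pW) (≤-reflexive (trans (^-distribʳ-* p (fromℕ W) s) (cong (p ^ℚ s *_) (sym (fromℕ-^ W s)))))

  u^d*n≤n^d : ∀ {μ u n} → 0ℚ < μ → 1 ℕ.≤ n → LePow1m u n μ → u ℕ.^ den μ ℕ.* n ℕ.≤ n ℕ.^ den μ
  u^d*n≤n^d {μ} {u} {n} 0<μ 1≤n u^d*n^k≤n^d =
    ℕ.≤-trans (ℕ.*-monoʳ-≤ (u ℕ.^ den μ) (NatFacts.m≤m^n 1≤n (1≤num 0<μ))) u^d*n^k≤n^d

module Construction (Δ D0 : ℕ) {n : ℕ} (G : FinAbGroup n) where

  open import Data.Nat.ListAction using (sum)
  open import Data.Bool using (true; false; not)
  open import Data.Bool.Properties using (not-injective)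
  open import Data.Fin using (zero; suc)
  open import Data.Fin.Subset using (Subset; ∣_∣; _∩_; ⋃; _∈_; _∉_; _⊆_)
  open import Data.Fin.Subset.Properties using (∣p∩q∣≤∣q∣)
  open import Data.List using (_∷_; map; length; concat; concatMap; allFin; cartesianProduct)
  open import Data.List.Properties using (length-map; length-tabulate; map-∘)
  open import Data.Rational using (0ℚ; 1ℚ; ½; _-_; _*_; _≤_)
  open import Data.Rational.Properties using (≤-trans; ≤-reflexive; nonNegative⁻¹; module ≤-Reasoning)
  open import Data.List.Relation.Unary.All as All using (All)
  import Data.List.Relation.Unary.All.Properties as All
  import Data.List.Relation.Unary.AllPairs.Properties as AllPairs
  open import Data.List.Relation.Unary.Any as Any using (here; there)
  open import Data.List.Membership.Propositional using () renaming (_∈_ to _∈ₗ_)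
  open import Data.List.Membership.Propositional.Properties
    using (∈-map⁺; ∈-map⁻; ∈-concatMap⁺; ∈-allFin; ∈-cartesianProduct⁺)
  open import Data.Vec as Vec using (Vec)
  open import Data.Vec.Properties using (length-toList)
  open import Data.Product using (∃; _×_; _,_; proj₁; proj₂)
  open import Function using (_∘_)
  import Algebra.Structures as Structures
  open Lists
  open Subsets
  open RandomSubsets
  open Rationals
  open Parameters Δ D0
  open FinAbGroup G
  open Structures.IsAbelianGroup isAbelianGroup using (identityʳ)

  1≤n : 1 ℕ.≤ n
  1≤n with 0g
  ... | zero  = ℕ.s≤s ℕ.z≤n
  ... | suc _ = ℕ.s≤s ℕ.z≤n

  -- 0 is an offset so that x, y and z themselves lie in their cell
  offsets : Vec (Fin n) Δ → List (Fin n)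
  offsets v = 0g ∷ Vec.toList v

  module Conf (b : Fin n) (v : Vec (Fin n) Δ) = Configurations G b (offsets v)
  open Conf using (Pair; cell; translates; third; Separated; Configuration)

  cellSize≡s : ∀ b v → Conf.cellSize b v ≡ s
  cellSize≡s b v = cong (λ l → suc l ℕ.+ (suc l ℕ.+ suc l)) (length-toList v)

  record Certificate (X : Subset n) (b : Fin n) (N U : Subset n) : Set where
    field
      v         : Vec (Fin n) Δ
      N⊆v       : ∀ {a} → a ∈ N → a ∈ₗ Vec.toList v
      x y       : Fin n
      separated : Separated b v (x , y)
      inside    : cell b v (x , y) ⊆ X
      outside   : ∣ cell b v (x , y) ∩ U ∣ ≡ 0

  certificate⇒goodSet : ∀ μ X → (∀ b N U → LePow1m ∣ U ∣ n μ → ∣ N ∣ ℕ.≤ Δ → Certificate X b N U) →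
    GoodSet G Δ μ X
  certificate⇒goodSet μ X certify b N U ∣U∣≤ ∣N∣≤ =
    x , y , third b v (x , y) ,
    translate₀∈X∖U (Conf.∈-translates-fst b v (here refl)) ,
    translate₀∈X∖U (Conf.∈-translates-snd b v (here refl)) ,
    translate₀∈X∖U (Conf.∈-translates-third b v (here refl)) ,
    Conf.third-sum b v x y ,
    (λ _ _ a∈N a′∈N → x#y (offset a∈N) (offset a′∈N)) ,
    (λ _ _ a∈N a′∈N → x#z (offset a∈N) (offset a′∈N)) ,
    (λ _ _ a∈N a′∈N → y#z (offset a∈N) (offset a′∈N)) ,
    (λ _ a∈N → translate∈X∖U (Conf.∈-translates-fst b v (offset a∈N))) ,
    (λ _ a∈N → translate∈X∖U (Conf.∈-translates-snd b v (offset a∈N))) ,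
    (λ _ a∈N → translate∈X∖U (Conf.∈-translates-third b v (offset a∈N)))
    where
    open Certificate (certify b N U ∣U∣≤ ∣N∣≤)
    x#y = proj₁ separated
    x#z = proj₁ (proj₂ separated)
    y#z = proj₂ (proj₂ separated)
    offset : ∀ {a} → a ∈ N → a ∈ₗ offsets v
    offset = there ∘ N⊆v
    translate∈X∖U : ∀ {i} → i ∈ₗ translates b v (x , y) → i ∈ X × i ∉ U
    translate∈X∖U i∈ = inside (∈-toSubset⁺ i∈) , ∣p∩q∣≡0⇒x∈p⇒x∉q outside (∈-toSubset⁺ i∈)
    translate₀∈X∖U : ∀ {u} → u ⊕ 0g ∈ₗ translates b v (x , y) → u ∈ X × u ∉ U
    translate₀∈X∖U {u} u∈ = subst (λ i → i ∈ X × i ∉ U) (identityʳ u) (translate∈X∖U u∈)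

  module _ (roomy : totalPairs n ℕ.* (s ℕ.* s) ℕ.≤ n) where

    chosen : ∀ b v → ∃ λ ps → length ps ≡ totalPairs n × Configuration b v ps
    chosen b v = Conf.greedy b v (totalPairs n) (ℕ.s≤s ℕ.z≤n) 1≤n
      (subst (λ t → totalPairs n ℕ.* (t ℕ.* t) ℕ.≤ n) (sym (cellSize≡s b v)) roomy)

    blocksOf : ∀ b v → List (List (Pair b v))
    blocksOf b v = chunks (L n) (blocks n) (proj₁ (chosen b v))

    blockFails : ∀ b v → List (Pair b v) → Event n
    blockFails b v B = containsNone (map (cell b v) B)

    failures : List (Event n)
    failures = concatMap (λ (b , v) → map (blockFails b v) (blocksOf b v)) (cartesianProduct (allFin n) (allVecs n Δ))

    good : Event n
    good = not ∘ someOf failures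

    blocks-valid : ∀ b v → All (λ B → length B ≡ L n × Configuration b v B) (blocksOf b v)
    blocks-valid b v = All.zip
      ( length-∈-chunks (L n) (blocks n) ps length≡
      , All-chunks (Configuration b v) (L n) (blocks n) ps
          (Conf.configuration-take b v (L n)) (Conf.configuration-drop b v (L n)) conf)
      where
      ps = proj₁ (chosen b v)
      length≡ = proj₁ (proj₂ (chosen b v))
      conf = proj₂ (proj₂ (chosen b v))

    length-failures : length failures ≡ n ℕ.* n ℕ.^ Δ ℕ.* blocks n
    length-failures = trans
      (length-concatMap _ (blocks n) (cartesianProduct (allFin n) (allVecs n Δ))
        (λ (b , v) → trans (length-map (blockFails b v) (blocksOf b v)) (length-chunks (L n) (blocks n) _)))
      (cong (ℕ._* blocks n) (trans (length-cartesianProductWith _,_ (allFin n) (allVecs n Δ))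
        (cong₂ ℕ._*_ (length-tabulate {n = n} (λ i → i)) (length-allVecs n Δ))))

    module _ (p : ℚ) (0≤p : 0ℚ ≤ p) (p≤1 : p ≤ 1ℚ) (1≤p^s*W^s : 1ℚ ≤ p ^ℚ s * fromℕ (W n ℕ.^ s)) where

      probOf-blockFails : ∀ b v {B} → length B ≡ L n × Configuration b v B →
        probOf n p (blockFails b v B) ≤ ½ ^ℚ (c ℕ.* W n ℕ.+ root n)
      probOf-blockFails b v {B} (length≡ , conf) = begin
        probOf n p (containsNone (map (cell b v) B))
          ≤⟨ probOf-containsNone n p s _ 0≤p p≤1 sizes disjoint ⟩
        (1ℚ - p ^ℚ s) ^ℚ length (map (cell b v) B)
          ≡⟨ cong ((1ℚ - p ^ℚ s) ^ℚ_) (trans (length-map (cell b v) B) length≡) ⟩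
        (1ℚ - p ^ℚ s) ^ℚ (W n ℕ.^ s ℕ.* (c ℕ.* W n ℕ.+ root n))
          ≤⟨ bernoulli-½^ (p ^ℚ s) (W n ℕ.^ s) _ (^-nonNeg s 0≤p) (^-≤1 s 0≤p p≤1) 1≤p^s*W^s ⟩
        ½ ^ℚ (c ℕ.* W n ℕ.+ root n) ∎
        where
        open ≤-Reasoning
        sizes = All.map⁺ (All.tabulate λ {pr} _ →
          subst (∣ cell b v pr ∣ ℕ.≤_) (cellSize≡s b v) (Conf.∣cell∣≤cellSize b v pr))
        disjoint = AllPairs.map⁺ (Configuration.disjoint conf)

      probOf-good : 1ℚ - ½ ^ℚ root n ≤ probOf n p good
      probOf-good = begin
        1ℚ - ½ ^ℚ root n                    ≤⟨ -‿antimonoʳ-≤ 1ℚ someFailure≤ ⟩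
        1ℚ - probOf n p (someOf failures)   ≡⟨ probOf-not′ n p (someOf failures) ⟨
        probOf n p good                     ∎
        where
        open ≤-Reasoning
        β = ½ ^ℚ (c ℕ.* W n ℕ.+ root n)
        each≤β : All (λ e → probOf n p e ≤ β) failures
        each≤β = All.concat⁺ (All.map⁺ (All.tabulate {xs = cartesianProduct (allFin n) (allVecs n Δ)} λ { {b , v} _ →
                   All.map⁺ (All.map (probOf-blockFails b v) (blocks-valid b v)) }))
        someFailure≤ : probOf n p (someOf failures) ≤ ½ ^ℚ root n
        someFailure≤ = begin
          probOf n p (someOf failures)    ≤⟨ probOf-someOf n p β failures 0≤p p≤1 each≤β ⟩
          fromℕ (length failures) * β     ≤⟨ *-monoʳ-≤ (^-nonNeg (c ℕ.* W n ℕ.+ root n) (nonNegative⁻¹ ½))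
                                               (fromℕ-mono-≤ (ℕ.≤-trans (ℕ.≤-reflexive length-failures) (#events≤ n))) ⟩
          fromℕ (2 ℕ.^ (c ℕ.* W n)) * β   ≡⟨ 2^a*½^[a+t]≡½^t (c ℕ.* W n) (root n) ⟩
          ½ ^ℚ root n                     ∎

    good⇒containedCells : ∀ X → good X ≡ true → ∀ b v →
      All (λ B → ∃ λ pr → pr ∈ₗ B × contains (cell b v pr) X ≡ true) (blocksOf b v)
    good⇒containedCells X goodX b v = All.tabulate λ {B} B∈bs →
      let T , T∈ , T⊆X = containsNone≡false (map (cell b v) B) X (noFailure B∈bs)
          pr , pr∈B , T≡ = ∈-map⁻ (cell b v) T∈
      in pr , pr∈B , subst (λ T → contains T X ≡ true) T≡ T⊆X
      where
      noFailure : ∀ {B} → B ∈ₗ blocksOf b v → blockFails b v B X ≡ false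
      noFailure B∈bs = someOf-false failures X (not-injective goodX)
        (∈-concatMap⁺ (λ (b , v) → map (blockFails b v) (blocksOf b v))
          (Any.map (λ { refl → ∈-map⁺ (blockFails b v) B∈bs }) (∈-cartesianProduct⁺ (∈-allFin b) (∈-allVecs v))))

    good⇒certificate : ∀ {μ} → (∀ u → LePow1m u n μ → u ℕ.≤ K n) → ∀ X → good X ≡ true →
      ∀ b N U → LePow1m ∣ U ∣ n μ → ∣ N ∣ ℕ.≤ Δ → Certificate X b N U
    good⇒certificate ≤K X goodX b N U ∣U∣≤ ∣N∣≤Δ = record
      { v = v ; N⊆v = ∈-padding 0g N ∣N∣≤Δ ; x = proj₁ pr ; y = proj₂ pr
      ; separated = All.lookup (Configuration.separated conf) pr∈ps
      ; inside = contains⇒⊆ pr⊆X ; outside = pr∩U≡0 }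
      where
      v = padding 0g N ∣N∣≤Δ
      ps = proj₁ (chosen b v)
      concat≡ = concat-chunks (L n) (blocks n) ps (proj₁ (proj₂ (chosen b v)))
      conf = proj₂ (proj₂ (chosen b v))
      bs = blocksOf b v
      meetsU : Pair b v → ℕ
      meetsU pr = ∣ cell b v pr ∩ U ∣

      totalMeets< : sum (map meetsU (concat bs)) ℕ.< length bs
      totalMeets< = begin-strict
        sum (map meetsU (concat bs))                     ≡⟨ cong (sum ∘ map meetsU) concat≡ ⟩
        sum (map meetsU ps)                              ≡⟨ cong sum (map-∘ ps) ⟩
        sum (map (λ T → ∣ T ∩ U ∣) (map (cell b v) ps))  ≡⟨ sum-∣∩∣ U _ (AllPairs.map⁺ (Configuration.disjoint conf)) ⟩
        ∣ ⋃ (map (cell b v) ps) ∩ U ∣                    ≤⟨ ∣p∩q∣≤∣q∣ (⋃ (map (cell b v) ps)) U ⟩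
        ∣ U ∣                                            ≤⟨ ≤K ∣ U ∣ ∣U∣≤ ⟩
        K n                                              <⟨ ℕ.n<1+n (K n) ⟩
        blocks n                                         ≡⟨ length-chunks (L n) (blocks n) ps ⟨
        length bs                                        ∎
        where open ℕ.≤-Reasoning

      found = blocks-pigeonhole meetsU (λ pr → contains (cell b v pr) X ≡ true) bs
                (good⇒containedCells X goodX b v) totalMeets<
      pr = proj₁ found
      pr∈ps = subst (pr ∈ₗ_) concat≡ (proj₁ (proj₂ found))
      pr⊆X = proj₁ (proj₂ (proj₂ found))
      pr∩U≡0 = proj₂ (proj₂ (proj₂ found))

module Conclusion (Δ : ℕ) (μ : ℚ) where

  open import Data.Rational as ℚ using (0ℚ; 1ℚ; ½; _-_; _≤_; _<_)
  open import Data.Rational.Properties using (≤-reflexive; ≤-<-trans; nonNegative⁻¹; 0≤p⇒∣p∣≡p; +-inverseʳ)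
  open import Data.Bool using (true; false)
  open import Data.Product using (_,_)
  open import Relation.Nullary using (yes; no)
  open import Data.Empty using (⊥-elim)
  open Rationals
  open RandomSubsets
  open Exponents
  open Parameters Δ (ℚ.denominator-1 μ)

  ρ₀ : ℚ
  ρ₀ = 1/[1+ ℕ.pred R ]

  0<ρ₀ : 0ℚ < ρ₀
  0<ρ₀ = 0<1/[1+k] (ℕ.pred R)

  -- for small n there is no room for the construction and the bound is trivial
  failure : ℕ → ℚ
  failure n with totalPairs n ℕ.* (s ℕ.* s) ℕ.≤? n
  ... | yes _ = ½ ^ℚ root n
  ... | no  _ = 1ℚ

  failure→0 : TendsToZero failure
  failure→0 δ 0<δ = t₀ ℕ.^ R , small
    where
    t₀ = threshold ℕ.⊔ suc (den δ)
    small : ∀ n → t₀ ℕ.^ R ℕ.≤ n → ℚ.∣ failure n ∣ < δ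
    small n t₀^R≤n with totalPairs n ℕ.* (s ℕ.* s) ℕ.≤? n
    ... | no ¬roomy = ⊥-elim (¬roomy (room n 1≤n (ℕ.≤-trans (ℕ.m≤m⊔n threshold _) t₀≤T)))
      where
      1≤n = ℕ.≤-trans (NatFacts.1≤m^n R (ℕ.≤-trans (ℕ.s≤s ℕ.z≤n) (ℕ.m≤n⊔m threshold _))) t₀^R≤n
      t₀≤T = root-max n t₀^R≤n
    ... | yes _ = ≤-<-trans (≤-reflexive (0≤p⇒∣p∣≡p (^-nonNeg (root n) (nonNegative⁻¹ ½))))
      (≤-<-trans (½^t≤1/[1+k] (root n) (den δ) 1+d≤2^T) (1/[1+den]<q 0<δ))
      where
      1+d≤2^T = ℕ.≤-trans (ℕ.≤-trans (ℕ.m≤n⊔m threshold _) (root-max n t₀^R≤n)) (ℕ.<⇒≤ (NatFacts.n<2^n (root n)))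

  goodWithHighProbability : 0ℚ < μ → ∀ ρ → 0ℚ < ρ → ρ ≤ ρ₀ →
    (n : ℕ) (G : FinAbGroup n) (p : ℚ) → 0ℚ ≤ p → p ≤ 1ℚ → NegPowLe n ρ p →
    ProbAtLeast n p (1ℚ - failure n) (GoodSet G Δ μ)
  goodWithHighProbability 0<μ ρ 0<ρ ρ≤ρ₀ n G p 0≤p p≤1 n^-ρ≤p with totalPairs n ℕ.* (s ℕ.* s) ℕ.≤? n
  ... | no  _     = (λ _ → false) , (λ _ ()) , ≤-reflexive (trans (+-inverseʳ 1ℚ) (sym (probOf-false n p)))
  ... | yes roomy = good roomy , good⇒goodSet , probOf-good roomy p 0≤p p≤1 1≤p^s*W^s′
    where
    open Construction Δ (ℚ.denominator-1 μ) G
    ∣U∣≤K : ∀ u → LePow1m u n μ → u ℕ.≤ K n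
    ∣U∣≤K u ∣U∣≤n^[1-μ] = u≤K n u 1≤n (u^d*n≤n^d {μ} {u} {n} 0<μ 1≤n ∣U∣≤n^[1-μ])
    good⇒goodSet : ∀ X → good roomy X ≡ true → GoodSet G Δ μ X
    good⇒goodSet X goodX = certificate⇒goodSet μ X (good⇒certificate roomy {μ} ∣U∣≤K X goodX)
    1≤p^s*W^s′ : 1ℚ ≤ p ^ℚ s ℚ.* fromℕ (W n ℕ.^ s)
    1≤p^s*W^s′ = 1≤p^s*W^s {p} (W n) s (1≤p*W {p} {n} (ℕ.pred R) (W n) 0≤p (ℕ.<⇒≤ (n<[1+root]^R n))
      (1≤p^R*n {n} {ρ} {p} R 0≤p 1≤n (num*[1+k]≤den {ρ} (ℕ.pred R) 0<ρ ρ≤ρ₀) n^-ρ≤p))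

open import Data.Nat using (ℕ; _≤_)
open import Data.Rational using (ℚ; 0ℚ; 1ℚ; _<_; _-_) renaming (_≤_ to _≤ℚ_)
open import Data.Product using (Σ; _×_; _,_)

lemma4p2 : (Δ : ℕ) → 1 ≤ Δ →
    Σ ℚ λ μ₀ → (0ℚ < μ₀) ×
    ((μ : ℚ) → 0ℚ < μ → μ ≤ℚ μ₀ →
      Σ ℚ λ ρ₀ → (0ℚ < ρ₀) ×
      ((ρ : ℚ) → 0ℚ < ρ → ρ ≤ℚ ρ₀ →
        Σ (ℕ → ℚ) λ ε → TendsToZero ε ×
        ((n : ℕ) (G : FinAbGroup n) (p : ℚ) → 0ℚ ≤ℚ p → p ≤ℚ 1ℚ → NegPowLe n ρ p →
          ProbAtLeast n p (1ℚ - ε n) (GoodSet G Δ μ))))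
lemma4p2 Δ _ = 1ℚ , Exponents.0<1/[1+k] 0 , λ μ 0<μ _ → let open Conclusion Δ μ in
  ρ₀ , 0<ρ₀ , λ ρ 0<ρ ρ≤ρ₀ → failure , failure→0 , goodWithHighProbability 0<μ ρ 0<ρ ρ≤ρ₀
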